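{- For all integers $k\ge 0$ and $\ell_1,\ldots,\ell_k \geq 1$, in the game $\mathbf{0.33}$ we have $\mathcal{G}(S_{\ell_1,\ldots,\ell_k})=\mathcal{G}(S_{\ell_1 \bmod 3,\ldots,\ell_k \bmod 3})$.
   Context: The game $\mathbf{0.33}$ on a finite graph $G$: players alternate; a move chooses a set $X$ of one vertex or of two adjacent vertices of $G$, lying in a connected component $H$ of $G$, such that $H-X$ is empty or connected, and deletes $X$. A player unable to move loses (normal play). Grundy value: $\mathcal{G}(G)=\mathrm{mex}\{\mathcal{G}(G'): G' \text{ reachable in one move}\}$, with $\mathrm{mex}(A)$ the least nonnegative integer not in $A$. Subdivided star $S_{\ell_1,\ldots,\ell_k}$ ($k\ge0$): a central vertex $c$ together with $k$ vertex-disjoint paths having $\ell_1,\ldots,\ell_k$ vertices respectively, each path having one endpoint adjacent to $c$. In particular, with $k=0$ it is the single vertex $P_1$. An index equal to $0$ means that no path is attached (such entries are simply omitted), so e.g. $S_{3,1}$ reduces to $S_{0,1}=S_{1}=P_2$. -}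

module Defs where

open import Data.Bool using (Bool; true; false; _∧_; _∨_; not; if_then_else_)
open import Data.Nat using (ℕ; zero; suc; _+_; _≡ᵇ_)
open import Data.List using (List; []; _∷_; _++_; map; length; upTo; concatMap; filter)
open import Data.Bool.ListAction using (any; all)
open import Data.Nat.ListAction using (sum)
open import Data.Product using (_×_; _,_)
open import Function using (_∘_)

-- A finite (simple, undirected) graph together with the set of vertices still present.
-- Vertices are the naturals v < n with alive v = true.  Two distinct present vertices
-- u, v are adjacent iff edge u v or edge v u (so edge is read symmetrically, loops ignored).
record Position : Set where
  field
    n     : ℕ
    edge  : ℕ → ℕ → Bool
    alive : ℕ → Bool
open Position public

verts : Position → List ℕ
verts p = Data.List.filter (λ v → Data.Bool.T? (alive p v)) (upTo (n p))
  where import Data.Bool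

E : Position → ℕ → ℕ → Bool
E p u v = alive p u ∧ alive p v ∧ (edge p u v ∨ edge p v u) ∧ not (u ≡ᵇ v)

step : Position → (ℕ → Bool) → (ℕ → Bool)
step p R w = R w ∨ any (λ u → R u ∧ E p u w) (upTo (n p))

iter : ℕ → ((ℕ → Bool) → (ℕ → Bool)) → (ℕ → Bool) → (ℕ → Bool)
iter zero    f R = R
iter (suc k) f R = f (iter k f R)

-- reach p v w = true iff w lies in the connected component of v (both present)
-- (n rounds suffice since there are at most n vertices)
reach : Position → ℕ → ℕ → Bool
reach p v = iter (n p) (step p) (λ w → alive p v ∧ (w ≡ᵇ v))

_∈ᵇ_ : ℕ → List ℕ → Bool
w ∈ᵇ X = any (w ≡ᵇ_) X

del : Position → List ℕ → Position
del p X = record { n = n p ; edge = edge p ; alive = λ w → alive p w ∧ not (w ∈ᵇ X) }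

candidates : Position → List (List ℕ)
candidates p =
  map (λ v → v ∷ []) (verts p)
  ++ concatMap (λ u → concatMap (λ v → if E p u v then ((u ∷ v ∷ []) ∷ []) else []) (upTo (n p)))
               (upTo (n p))

-- X (nonempty, inside the component H of its first vertex) is a legal move iff
-- H - X is empty or connected: any two vertices of H - X are connected in G - X.
legal : Position → List ℕ → Bool
legal p [] = false
legal p (x ∷ X) =
  all (λ w → all (λ w' →
        not (inHX w ∧ inHX w') ∨ reach (del p (x ∷ X)) w w')
      (upTo (n p))) (upTo (n p))
  where
    inHX : ℕ → Bool
    inHX w = reach p x w ∧ not (w ∈ᵇ (x ∷ X))

moves : Position → List (List ℕ)
moves p = Data.List.filter (λ X → Data.Bool.T? (legal p X)) (candidates p)
  where import Data.Bool

-- minimum excludant (the mex of a list xs is at most length xs)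
mexFrom : ℕ → ℕ → List ℕ → ℕ
mexFrom zero    m xs = m
mexFrom (suc f) m xs = if m ∈ᵇ xs then mexFrom f (suc m) xs else m

mex : List ℕ → ℕ
mex xs = mexFrom (length xs) 0 xs

-- Grundy value with fuel; fuel ≥ number of present vertices makes it exact,
-- since every move deletes at least one vertex.
grundyF : ℕ → Position → ℕ
grundyF zero    p = 0
grundyF (suc f) p = mex (map (grundyF f ∘ del p) (moves p))

𝒢 : Position → ℕ
𝒢 p = grundyF (n p) p

-- Subdivided star S_{ℓ1,...,ℓk}: centre 0, the i-th path occupies the next ℓi vertices.
chain : ℕ → ℕ → List (ℕ × ℕ)
chain o zero    = []
chain o (suc l) = (o , suc o) ∷ chain (suc o) l

pathEdges : ℕ → ℕ → List (ℕ × ℕ)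
pathEdges o zero    = []
pathEdges o (suc l) = (0 , o) ∷ chain o l

starEdges : ℕ → List ℕ → List (ℕ × ℕ)
starEdges o []       = []
starEdges o (l ∷ ls) = pathEdges o l ++ starEdges (o + l) ls

isEdge : List (ℕ × ℕ) → ℕ → ℕ → Bool
isEdge es u v = any (λ { (a , b) → (a ≡ᵇ u) ∧ (b ≡ᵇ v) }) es

star : List ℕ → Position
star ls = record { n = suc (sum ls) ; edge = isEdge (starEdges 1 ls) ; alive = λ _ → true }

module Submission where

-- Every position reachable from a subdivided star is either the star with its arms shortened
-- (centre present) or, once the centre is gone, a segment of a single arm: deleting a vertex
-- inside an arm, or the centre of a star that is not a path, disconnects the component, so a
-- legal move shortens one arm by one or two vertices unless the star is a path.  Hence the Grundy
-- value of the star is the function starValue of its arm lengths, a path on m vertices having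
-- value m mod 3.  Shortening an arm of length at least 3 by 3 does not change starValue: by
-- induction, the options of the shorter star lift to options of the longer one, and every other
-- option of the longer star has the shorter star as an option.

open import Defs
open import Data.Bool using (Bool; true; false; _∧_; _∨_; not; if_then_else_; T; T?)
open import Data.Bool.ListAction using (any; all)
open import Data.Bool.Properties using (∨-comm)
open import Data.Nat using (ℕ; zero; suc; pred; _+_; _∸_; _≤_; _<_; _%_; _≡ᵇ_; _≤ᵇ_; _<ᵇ_; z≤n; s≤s; _≟_; _≤?_; _<?_; >-nonZero)
open import Data.Nat.Properties
open import Data.Nat.DivMod using ([m+n]%n≡m%n)
open import Data.Nat.ListAction using (sum)
open import Data.List using (List; []; _∷_; _++_; map; length; upTo; concatMap)
open import Data.List.Properties using (map-cong; map-cong-local; ++-assoc)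
open import Data.List.Membership.Propositional using (_∈_)
open import Data.List.Membership.Propositional.Properties
  using (∈-upTo⁺; ∈-upTo⁻; ∈-filter⁺; ∈-filter⁻; ∈-++⁺ˡ; ∈-++⁺ʳ; ∈-++⁻; ∈-concat⁺′; ∈-concat⁻′; ∈-map⁺; ∈-map⁻)
open import Data.List.Relation.Unary.Any using (here; there)
open import Data.List.Relation.Unary.All using (All; tabulate)
open import Data.Product using (_×_; _,_; ∃; proj₁; proj₂)
open import Data.Sum using (_⊎_; inj₁; inj₂)
open import Data.Empty using (⊥; ⊥-elim)
open import Function using (_∘_)
open import Relation.Binary using (tri<; tri≈; tri>)
open import Relation.Binary.PropositionalEquality
open import Relation.Nullary using (¬_; yes; no)


-- Booleans, membership and the minimum excludant

true≢false : true ≢ false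
true≢false ()

T⇒≡true : ∀ {b} → T b → b ≡ true
T⇒≡true {true} _ = refl

≡true⇒T : ∀ {b} → b ≡ true → T b
≡true⇒T refl = _

∨-true⁻ : ∀ a b → a ∨ b ≡ true → a ≡ true ⊎ b ≡ true
∨-true⁻ true b _ = inj₁ refl
∨-true⁻ false b e = inj₂ e

∧-true⁻ : ∀ a b → a ∧ b ≡ true → a ≡ true × b ≡ true
∧-true⁻ true true _ = refl , refl

∧-true⁺ : ∀ {a b} → a ≡ true → b ≡ true → a ∧ b ≡ true
∧-true⁺ refl refl = refl

∨-trueˡ⁺ : ∀ {a} b → a ≡ true → a ∨ b ≡ true
∨-trueˡ⁺ b refl = refl

∨-trueʳ⁺ : ∀ a {b} → b ≡ true → a ∨ b ≡ true
∨-trueʳ⁺ true _ = refl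
∨-trueʳ⁺ false e = e

not-true⁻ : ∀ {a} → not a ≡ true → a ≡ false
not-true⁻ {false} _ = refl

≡ᵇ-true⁻ : ∀ m n → (m ≡ᵇ n) ≡ true → m ≡ n
≡ᵇ-true⁻ m n e = ≡ᵇ⇒≡ m n (≡true⇒T e)

≡ᵇ-refl : ∀ n → (n ≡ᵇ n) ≡ true
≡ᵇ-refl n = T⇒≡true (≡⇒≡ᵇ n n refl)

≢⇒≡ᵇ-false : ∀ m n → m ≢ n → (m ≡ᵇ n) ≡ false
≢⇒≡ᵇ-false m n ne with m ≡ᵇ n in eq
... | true = ⊥-elim (ne (≡ᵇ-true⁻ m n eq))
... | false = refl

any-true⁺ : ∀ {A : Set} (f : A → Bool) {x} xs → x ∈ xs → f x ≡ true → any f xs ≡ true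
any-true⁺ f (y ∷ ys) (here refl) e = ∨-trueˡ⁺ _ e
any-true⁺ f (y ∷ ys) (there m) e = ∨-trueʳ⁺ (f y) (any-true⁺ f ys m e)

any-true⁻ : ∀ {A : Set} (f : A → Bool) xs → any f xs ≡ true → ∃ λ x → x ∈ xs × f x ≡ true
any-true⁻ f (y ∷ ys) e with ∨-true⁻ (f y) _ e
... | inj₁ e₁ = y , here refl , e₁
... | inj₂ e₂ with any-true⁻ f ys e₂
... | x , m , e₃ = x , there m , e₃

any-cong : ∀ {A : Set} (f g : A → Bool) xs → (∀ x → x ∈ xs → f x ≡ g x) → any f xs ≡ any g xs
any-cong f g [] h = refl
any-cong f g (y ∷ ys) h = cong₂ _∨_ (h y (here refl)) (any-cong f g ys (λ x m → h x (there m)))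

all-true⁺ : ∀ {A : Set} (f : A → Bool) xs → (∀ x → x ∈ xs → f x ≡ true) → all f xs ≡ true
all-true⁺ f [] h = refl
all-true⁺ f (y ∷ ys) h = ∧-true⁺ (h y (here refl)) (all-true⁺ f ys (λ x m → h x (there m)))

all-true⁻ : ∀ {A : Set} (f : A → Bool) xs → all f xs ≡ true → ∀ {x} → x ∈ xs → f x ≡ true
all-true⁻ f (y ∷ ys) e (here refl) = proj₁ (∧-true⁻ (f y) _ e)
all-true⁻ f (y ∷ ys) e (there m) = all-true⁻ f ys (proj₂ (∧-true⁻ (f y) _ e)) m

∈ᵇ⇒∈ : ∀ w xs → (w ∈ᵇ xs) ≡ true → w ∈ xs
∈ᵇ⇒∈ w xs e with any-true⁻ (w ≡ᵇ_) xs e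
... | x , m , e′ rewrite ≡ᵇ-true⁻ w x e′ = m

∈⇒∈ᵇ : ∀ w xs → w ∈ xs → (w ∈ᵇ xs) ≡ true
∈⇒∈ᵇ w xs m = any-true⁺ (w ≡ᵇ_) xs m (≡ᵇ-refl w)

remove : ℕ → List ℕ → List ℕ
remove m [] = []
remove m (y ∷ ys) = if y ≡ᵇ m then remove m ys else y ∷ remove m ys

length-remove≤ : ∀ m ys → length (remove m ys) ≤ length ys
length-remove≤ m [] = z≤n
length-remove≤ m (y ∷ ys) with y ≡ᵇ m
... | true = m≤n⇒m≤1+n (length-remove≤ m ys)
... | false = s≤s (length-remove≤ m ys)

length-remove< : ∀ m ys → m ∈ ys → length (remove m ys) < length ys
length-remove< m (y ∷ ys) (here refl) rewrite ≡ᵇ-refl y = s≤s (length-remove≤ y ys)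
length-remove< m (y ∷ ys) (there p) with y ≡ᵇ m
... | true = m≤n⇒m≤1+n (length-remove< m ys p)
... | false = s≤s (length-remove< m ys p)

∈-remove⁺ : ∀ m j ys → j ≢ m → j ∈ ys → j ∈ remove m ys
∈-remove⁺ m j (y ∷ ys) ne (here refl) rewrite ≢⇒≡ᵇ-false j m ne = here refl
∈-remove⁺ m j (y ∷ ys) ne (there p) with y ≡ᵇ m
... | true = ∈-remove⁺ m j ys ne p
... | false = there (∈-remove⁺ m j ys ne p)

prefix⊆⇒≤length : ∀ m xs → (∀ j → j < m → j ∈ xs) → m ≤ length xs
prefix⊆⇒≤length zero xs h = z≤n
prefix⊆⇒≤length (suc m) xs h =
  ≤-<-trans (prefix⊆⇒≤length m (remove m xs) (λ j j<m → ∈-remove⁺ m j xs (<⇒≢ j<m) (h j (m<n⇒m<1+n j<m))))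
            (length-remove< m xs (h m ≤-refl))

<suc⇒<⊎≡ : ∀ {i j} → i < suc j → i < j ⊎ i ≡ j
<suc⇒<⊎≡ i<sj = m≤n⇒m<n∨m≡n (≤-pred i<sj)

mexFrom-spec : ∀ f j xs → (∀ i → i < j → i ∈ xs) →
  (∀ i → i < mexFrom f j xs → i ∈ xs) × ((mexFrom f j xs ∈ᵇ xs) ≡ false ⊎ mexFrom f j xs ≡ j + f)
mexFrom-spec zero j xs h = h , inj₂ (sym (+-identityʳ j))
mexFrom-spec (suc f) j xs h with j ∈ᵇ xs in eq
... | false = h , inj₁ eq
... | true with mexFrom-spec f (suc j) xs below-suc
  where
  below-suc : ∀ i → i < suc j → i ∈ xs
  below-suc i i<sj with <suc⇒<⊎≡ i<sj
  ... | inj₁ lt = h i lt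
  ... | inj₂ refl = ∈ᵇ⇒∈ i xs eq
... | below , inj₁ absent = below , inj₁ absent
... | below , inj₂ exhausted = below , inj₂ (trans exhausted (sym (+-suc j f)))

-- When the search runs out of fuel, all of 0 … length xs would lie in xs, which pigeonhole forbids.
mex-spec : ∀ xs → ((mex xs ∈ᵇ xs) ≡ false) × (∀ i → i < mex xs → i ∈ xs)
mex-spec xs with mexFrom-spec (length xs) 0 xs (λ i ())
... | below , inj₁ absent = absent , below
... | below , inj₂ exhausted with mex xs ∈ᵇ xs in eq
... | false = refl , below
... | true = ⊥-elim (<-irrefl refl (≤-trans (prefix⊆⇒≤length (suc (mex xs)) xs upto-mex) (≤-reflexive (sym exhausted))))
  where
  upto-mex : ∀ j → j < suc (mex xs) → j ∈ xs
  upto-mex j j< with <suc⇒<⊎≡ j<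
  ... | inj₁ lt = below j lt
  ... | inj₂ refl = ∈ᵇ⇒∈ j xs eq

<mex⇒∈ : ∀ xs i → i < mex xs → i ∈ xs
<mex⇒∈ xs = proj₂ (mex-spec xs)

∈⇒≢mex : ∀ xs v → v ∈ xs → v ≢ mex xs
∈⇒≢mex xs v m e = true≢false (trans (sym (∈⇒∈ᵇ v xs m)) (trans (cong (_∈ᵇ xs) e) (proj₁ (mex-spec xs))))

mex-unique : ∀ xs m → (∀ v → v ∈ xs → v ≢ m) → (∀ i → i < m → i ∈ xs) → mex xs ≡ m
mex-unique xs m absent below with <-cmp (mex xs) m
... | tri≈ _ e _ = e
... | tri< lt _ _ = ⊥-elim (∈⇒≢mex xs _ (below _ lt) refl)
... | tri> _ _ gt = ⊥-elim (absent m (<mex⇒∈ xs m gt) refl)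

mex-cong : ∀ xs ys → (∀ v → v ∈ xs → v ∈ ys) → (∀ v → v ∈ ys → v ∈ xs) → mex xs ≡ mex ys
mex-cong xs ys xs⊆ys ys⊆xs =
  sym (mex-unique ys (mex xs) (λ v m → ∈⇒≢mex xs v (ys⊆xs v m)) (λ j l → xs⊆ys j (<mex⇒∈ xs j l)))

-- Reachability and legal moves

count : ℕ → (ℕ → Bool) → ℕ
count zero R = 0
count (suc m) R = (if R m then 1 else 0) + count m R

count≤ : ∀ m R → count m R ≤ m
count≤ zero R = z≤n
count≤ (suc m) R with R m
... | true = s≤s (count≤ m R)
... | false = m≤n⇒m≤1+n (count≤ m R)

count-const-true : ∀ m → count m (λ _ → true) ≡ m
count-const-true zero = refl
count-const-true (suc m) = cong suc (count-const-true m)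

Included : ℕ → (ℕ → Bool) → (ℕ → Bool) → Set
Included m R R′ = ∀ u → u < m → R u ≡ true → R′ u ≡ true

Included-pred : ∀ {m R R′} → Included (suc m) R R′ → Included m R R′
Included-pred s u u<m = s u (m<n⇒m<1+n u<m)

count-mono : ∀ m R R′ → Included m R R′ → count m R ≤ count m R′
count-mono zero R R′ s = z≤n
count-mono (suc m) R R′ s with R m in e₁ | R′ m in e₂
... | true | true = s≤s (count-mono m R R′ (Included-pred s))
... | true | false = ⊥-elim (true≢false (trans (sym (s m ≤-refl e₁)) e₂))
... | false | true = m≤n⇒m≤1+n (count-mono m R R′ (Included-pred s))
... | false | false = count-mono m R R′ (Included-pred s)

count-≡⇒≗ : ∀ m R R′ → Included m R R′ → count m R ≡ count m R′ → ∀ u → u < m → R u ≡ R′ u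
count-≡⇒≗ (suc m) R R′ s e u u< with R m in e₁ | R′ m in e₂
... | true | false = ⊥-elim (true≢false (trans (sym (s m ≤-refl e₁)) e₂))
... | false | true = ⊥-elim (<-irrefl e (s≤s (count-mono m R R′ (Included-pred s))))
... | true | true with <suc⇒<⊎≡ u<
...   | inj₁ lt = count-≡⇒≗ m R R′ (Included-pred s) (suc-injective e) u lt
...   | inj₂ refl = trans e₁ (sym e₂)
count-≡⇒≗ (suc m) R R′ s e u u< | false | false with <suc⇒<⊎≡ u<
...   | inj₁ lt = count-≡⇒≗ m R R′ (Included-pred s) e u lt
...   | inj₂ refl = trans e₁ (sym e₂)

-- Each round before stabilisation adds a point below n, so n rounds reach the fixed point.
module Saturation (n : ℕ) (S : (ℕ → Bool) → (ℕ → Bool))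
  (inflationary : ∀ R w → R w ≡ true → S R w ≡ true)
  (local : ∀ R R′ → (∀ u → u < n → R u ≡ R′ u) → ∀ w → w < n → S R w ≡ S R′ w) where

  iter-mono : ∀ j k R w → j ≤ k → iter j S R w ≡ true → iter k S R w ≡ true
  iter-mono j k R w j≤k e with m≤n⇒m<n∨m≡n j≤k
  ... | inj₂ refl = e
  iter-mono j (suc k) R w j≤k e | inj₁ lt = inflationary (iter k S R) w (iter-mono j k R w (≤-pred lt) e)

  Stable : ℕ → (ℕ → Bool) → Set
  Stable k R = ∀ w → w < n → iter (suc k) S R w ≡ iter k S R w

  Stable-suc : ∀ k R → Stable k R → Stable (suc k) R
  Stable-suc k R st w w<n = local (iter (suc k) S R) (iter k S R) st w w<n

  growing-or-stable : ∀ k R → (k ≤ count n (iter k S R)) ⊎ Stable k R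
  growing-or-stable zero R = inj₁ z≤n
  growing-or-stable (suc k) R with growing-or-stable k R
  ... | inj₂ st = inj₂ (Stable-suc k R st)
  ... | inj₁ le with m≤n⇒m<n∨m≡n (count-mono n (iter k S R) (iter (suc k) S R) grows)
    where
    grows : Included n (iter k S R) (iter (suc k) S R)
    grows u _ = inflationary (iter k S R) u
  ...   | inj₁ lt = inj₁ (≤-trans (s≤s le) lt)
  ...   | inj₂ eq = inj₂ (Stable-suc k R (λ w w<n → sym (count-≡⇒≗ n _ _ (λ u _ → inflationary (iter k S R) u) eq w w<n)))

  Stable-n : ∀ R → Stable n R
  Stable-n R with growing-or-stable n R
  ... | inj₂ st = st
  ... | inj₁ le = λ w w<n → trans (inflationary (iter n S R) w (full w w<n)) (sym (full w w<n))
    where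
    full : ∀ w → w < n → iter n S R w ≡ true
    full = count-≡⇒≗ n (iter n S R) (λ _ → true) (λ _ _ _ → refl)
             (trans (≤-antisym (count≤ n _) le) (sym (count-const-true n)))

  Stable-+ : ∀ j R → Stable (j + n) R
  Stable-+ zero R = Stable-n R
  Stable-+ (suc j) R = Stable-suc (j + n) R (Stable-+ j R)

  iter-+n : ∀ j R w → w < n → iter (j + n) S R w ≡ iter n S R w
  iter-+n zero R w w<n = refl
  iter-+n (suc j) R w w<n = trans (Stable-+ j R w w<n) (iter-+n j R w w<n)

  iter-saturates : ∀ k R w → w < n → iter k S R w ≡ true → iter n S R w ≡ true
  iter-saturates k R w w<n e with ≤-total k n
  ... | inj₁ k≤n = iter-mono k n R w k≤n e
  ... | inj₂ n≤k = trans (sym (iter-+n (k ∸ n) R w w<n)) (trans (cong (λ z → iter z S R w) (m∸n+n≡m n≤k)) e)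

≡ᵇ-sym : ∀ a b → (a ≡ᵇ b) ≡ (b ≡ᵇ a)
≡ᵇ-sym zero zero = refl
≡ᵇ-sym zero (suc b) = refl
≡ᵇ-sym (suc a) zero = refl
≡ᵇ-sym (suc a) (suc b) = ≡ᵇ-sym a b

E-sym : ∀ p u w → E p u w ≡ E p w u
E-sym p u w rewrite ≡ᵇ-sym u w with alive p u | alive p w
... | true | true = cong (λ z → z ∧ not (w ≡ᵇ u)) (∨-comm (edge p u w) (edge p w u))
... | true | false = refl
... | false | true = refl
... | false | false = refl

E-true⁻ : ∀ p u w → E p u w ≡ true →
  alive p u ≡ true × alive p w ≡ true × (edge p u w ∨ edge p w u) ≡ true × u ≢ w
E-true⁻ p u w e with alive p u | alive p w | edge p u w ∨ edge p w u | u ≡ᵇ w in eq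
... | true | true | true | false = refl , refl , refl , λ { refl → true≢false (trans (sym (≡ᵇ-refl u)) eq) }

E-true⁺ : ∀ p u w → alive p u ≡ true → alive p w ≡ true → (edge p u w ∨ edge p w u) ≡ true → u ≢ w → E p u w ≡ true
E-true⁺ p u w a₁ a₂ e ne rewrite a₁ | a₂ | e | ≢⇒≡ᵇ-false u w ne = refl

data Walk (p : Position) : ℕ → ℕ → Set where
  [] : ∀ {v} → Walk p v v
  _∷_ : ∀ {u w x} → E p u w ≡ true → Walk p w x → Walk p u x

walk-length : ∀ {p u w} → Walk p u w → ℕ
walk-length [] = 0
walk-length (_ ∷ r) = suc (walk-length r)

_++ʷ_ : ∀ {p u v w} → Walk p u v → Walk p v w → Walk p u w
[] ++ʷ q = q
(e ∷ r) ++ʷ q = e ∷ (r ++ʷ q)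

_∷ʳʷ_ : ∀ {p u v w} → Walk p u v → E p v w ≡ true → Walk p u w
r ∷ʳʷ e = r ++ʷ (e ∷ [])

reverseʷ : ∀ {p u w} → Walk p u w → Walk p w u
reverseʷ [] = []
reverseʷ {p} {u} (_∷_ {w = w} e r) = reverseʷ r ∷ʳʷ trans (E-sym p w u) e

iter-comm : ∀ k (f : (ℕ → Bool) → (ℕ → Bool)) R → iter k f (f R) ≡ f (iter k f R)
iter-comm zero f R = refl
iter-comm (suc k) f R = cong f (iter-comm k f R)

EdgesBounded : Position → Set
EdgesBounded p = ∀ u w → E p u w ≡ true → u < n p × w < n p

step-inflationary : ∀ p R w → R w ≡ true → step p R w ≡ true
step-inflationary p R w e = ∨-trueˡ⁺ _ e

step-local : ∀ p R R′ → (∀ u → u < n p → R u ≡ R′ u) → ∀ w → w < n p → step p R w ≡ step p R′ w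
step-local p R R′ h w w< =
  cong₂ _∨_ (h w w<) (any-cong _ _ (upTo (n p)) (λ x m → cong (λ z → z ∧ E p x w) (h x (∈-upTo⁻ m))))

walk⇒iter : ∀ p → EdgesBounded p → ∀ {u w} (r : Walk p u w) R → R u ≡ true → iter (walk-length r) (step p) R w ≡ true
walk⇒iter p eb [] R e = e
walk⇒iter p eb (_∷_ {u = u} {w = w} x r) R e =
  subst (λ F → F _ ≡ true) (iter-comm (walk-length r) (step p) R)
    (walk⇒iter p eb r (step p R)
      (∨-trueʳ⁺ (R w) (any-true⁺ (λ v → R v ∧ E p v w) (upTo (n p)) (∈-upTo⁺ (proj₁ (eb u w x))) (∧-true⁺ e x))))

walk⇒reach : ∀ p → EdgesBounded p → ∀ {v w} → alive p v ≡ true → v < n p → Walk p v w → reach p v w ≡ true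
walk⇒reach p eb {v} {w} a v< r =
  S.iter-saturates (walk-length r) _ w (end<n r v<) (walk⇒iter p eb r _ start)
  where
  module S = Saturation (n p) (step p) (step-inflationary p) (step-local p)
  start : (alive p v ∧ (v ≡ᵇ v)) ≡ true
  start rewrite a | ≡ᵇ-refl v = refl
  end<n : ∀ {x y} → Walk p x y → x < n p → y < n p
  end<n [] l = l
  end<n (_∷_ {u = u} {w = w} e r) l = end<n r (proj₂ (eb u w e))

Closed : Position → (ℕ → Bool) → Set
Closed p C = ∀ u w → C u ≡ true → E p u w ≡ true → C w ≡ true

iter-closed : ∀ p C → Closed p C → ∀ k R → (∀ x → R x ≡ true → C x ≡ true) →
  ∀ w → iter k (step p) R w ≡ true → C w ≡ true
iter-closed p C cl zero R h w e = h w e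
iter-closed p C cl (suc k) R h w e with ∨-true⁻ _ _ e
... | inj₁ e₁ = iter-closed p C cl k R h w e₁
... | inj₂ e₂ with any-true⁻ _ (upTo (n p)) e₂
... | u , _ , e₃ with ∧-true⁻ (iter k (step p) R u) (E p u w) e₃
... | Ru , Euw = cl u w (iter-closed p C cl k R h u Ru) Euw

reach-closed : ∀ p C → Closed p C → ∀ v → C v ≡ true → ∀ w → reach p v w ≡ true → C w ≡ true
reach-closed p C cl v cv w e = iter-closed p C cl (n p) _ start w e
  where
  start : ∀ x → (alive p v ∧ (x ≡ᵇ v)) ≡ true → C x ≡ true
  start x e′ rewrite ≡ᵇ-true⁻ x v (proj₂ (∧-true⁻ (alive p v) _ e′)) = cv

reach-alive : ∀ p v w → reach p v w ≡ true → alive p w ≡ true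
reach-alive p v w e = iter-closed p (alive p) (λ u w _ e → proj₁ (proj₂ (E-true⁻ p u w e))) (n p) _ start w e
  where
  start : ∀ x → (alive p v ∧ (x ≡ᵇ v)) ≡ true → alive p x ≡ true
  start x e′ with ∧-true⁻ (alive p v) _ e′
  ... | av , xv rewrite ≡ᵇ-true⁻ x v xv = av

legal⁺ : ∀ p x X →
  (∀ w w′ → w < n p → w′ < n p → alive (del p (x ∷ X)) w ≡ true → alive (del p (x ∷ X)) w′ ≡ true →
     reach (del p (x ∷ X)) w w′ ≡ true) → legal p (x ∷ X) ≡ true
legal⁺ p x X h =
  all-true⁺ _ (upTo (n p)) λ w mw → all-true⁺ _ (upTo (n p)) λ w′ mw′ → pairwise w w′ (∈-upTo⁻ mw) (∈-upTo⁻ mw′)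
  where
  inHX : ℕ → Bool
  inHX w = reach p x w ∧ not (w ∈ᵇ (x ∷ X))
  inHX⇒alive : ∀ w → inHX w ≡ true → alive (del p (x ∷ X)) w ≡ true
  inHX⇒alive w e with ∧-true⁻ _ _ e
  ... | e₁ , e₂ = ∧-true⁺ (reach-alive p x w e₁) e₂
  pairwise : ∀ w w′ → w < n p → w′ < n p → (not (inHX w ∧ inHX w′) ∨ reach (del p (x ∷ X)) w w′) ≡ true
  pairwise w w′ l l′ with inHX w in i₁ | inHX w′ in i₂
  ... | false | _ = refl
  ... | true | false = refl
  ... | true | true = h w w′ l l′ (inHX⇒alive w i₁) (inHX⇒alive w′ i₂)

legal⁻ : ∀ p x X → legal p (x ∷ X) ≡ true → ∀ w w′ → w < n p → w′ < n p →
  reach p x w ≡ true → reach p x w′ ≡ true → (w ∈ᵇ (x ∷ X)) ≡ false → (w′ ∈ᵇ (x ∷ X)) ≡ false →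
  reach (del p (x ∷ X)) w w′ ≡ true
legal⁻ p x X lg w w′ l l′ r r′ m m′ = unfold (all-true⁻ _ (upTo (n p)) (all-true⁻ _ (upTo (n p)) lg (∈-upTo⁺ l)) (∈-upTo⁺ l′))
  where
  unfold : (not ((reach p x w ∧ not (w ∈ᵇ (x ∷ X))) ∧ (reach p x w′ ∧ not (w′ ∈ᵇ (x ∷ X)))) ∨ reach (del p (x ∷ X)) w w′) ≡ true →
           reach (del p (x ∷ X)) w w′ ≡ true
  unfold e rewrite r | r′ | m | m′ = e

SingleCandidate : Position → List ℕ → Set
SingleCandidate p X = ∃ λ v → X ≡ v ∷ [] × v < n p × alive p v ≡ true

PairCandidate : Position → List ℕ → Set
PairCandidate p X = ∃ λ u → ∃ λ v → X ≡ u ∷ v ∷ [] × u < n p × v < n p × E p u v ≡ true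

candidates⁻ : ∀ p X → X ∈ candidates p → SingleCandidate p X ⊎ PairCandidate p X
candidates⁻ p X m with ∈-++⁻ (map (λ v → v ∷ []) (verts p)) m
... | inj₁ m₁ with ∈-map⁻ (λ v → v ∷ []) m₁
... | v , mv , refl with ∈-filter⁻ (λ v → T? (alive p v)) {xs = upTo (n p)} mv
... | mu , av = inj₁ (v , refl , ∈-upTo⁻ mu , T⇒≡true av)
candidates⁻ p X m | inj₂ m₂ with ∈-concat⁻′ (map pairsFrom (upTo (n p))) m₂
  where
  pairsFrom : ℕ → List (List ℕ)
  pairsFrom u = concatMap (λ v → if E p u v then ((u ∷ v ∷ []) ∷ []) else []) (upTo (n p))
... | ys , Xys , ysin with ∈-map⁻ (λ u → concatMap (λ v → if E p u v then ((u ∷ v ∷ []) ∷ []) else []) (upTo (n p))) ysin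
... | u , mu , refl with ∈-concat⁻′ (map (λ v → if E p u v then ((u ∷ v ∷ []) ∷ []) else []) (upTo (n p))) Xys
... | zs , Xzs , zsin with ∈-map⁻ (λ v → if E p u v then ((u ∷ v ∷ []) ∷ []) else []) zsin
... | v , mv , refl with E p u v in eq
... | true with Xzs
... | here refl = inj₂ (u , v , refl , ∈-upTo⁻ mu , ∈-upTo⁻ mv , eq)

single∈candidates : ∀ p v → v < n p → alive p v ≡ true → (v ∷ []) ∈ candidates p
single∈candidates p v l a =
  ∈-++⁺ˡ (∈-map⁺ (λ v → v ∷ []) (∈-filter⁺ (λ v → T? (alive p v)) (∈-upTo⁺ l) (≡true⇒T a)))

pair∈candidates : ∀ p u v → u < n p → v < n p → E p u v ≡ true → (u ∷ v ∷ []) ∈ candidates p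
pair∈candidates p u v lu lv e = ∈-++⁺ʳ (map (λ v → v ∷ []) (verts p))
  (∈-concat⁺′ (∈-concat⁺′ selected (∈-map⁺ _ (∈-upTo⁺ lv))) (∈-map⁺ _ (∈-upTo⁺ lu)))
  where
  selected : (u ∷ v ∷ []) ∈ (if E p u v then ((u ∷ v ∷ []) ∷ []) else [])
  selected rewrite e = here refl

Move : Position → List ℕ → Set
Move p X = X ∈ candidates p × legal p X ≡ true

options : ℕ → Position → List ℕ
options f p = map (grundyF f ∘ del p) (moves p)

options⁺ : ∀ f p X → Move p X → grundyF f (del p X) ∈ options f p
options⁺ f p X (m , l) = ∈-map⁺ (grundyF f ∘ del p) (∈-filter⁺ (λ X → T? (legal p X)) m (≡true⇒T l))

options⁻ : ∀ f p v → v ∈ options f p → ∃ λ X → Move p X × v ≡ grundyF f (del p X)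
options⁻ f p v m with ∈-map⁻ (grundyF f ∘ del p) m
... | X , mX , refl with ∈-filter⁻ (λ X → T? (legal p X)) {xs = candidates p} mX
... | mc , l = X , (mc , T⇒≡true l) , refl

-- The subdivided star as a position

-- The i-th entry, and 0 beyond the end: missing arms are empty.
at : List ℕ → ℕ → ℕ
at [] i = 0
at (x ∷ xs) zero = x
at (x ∷ xs) (suc i) = at xs i

armStartFrom : ℕ → List ℕ → ℕ → ℕ
armStartFrom o [] i = o
armStartFrom o (l ∷ ls) zero = o
armStartFrom o (l ∷ ls) (suc i) = armStartFrom (o + l) ls i

armIndexFrom : ℕ → List ℕ → ℕ → ℕ
armIndexFrom o [] w = 0
armIndexFrom o (l ∷ ls) w = if w <ᵇ o + l then 0 else suc (armIndexFrom (o + l) ls w)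

<⇒<ᵇ-true : ∀ {a b} → a < b → (a <ᵇ b) ≡ true
<⇒<ᵇ-true l = T⇒≡true (<⇒<ᵇ l)

≥⇒<ᵇ-false : ∀ {a b} → b ≤ a → (a <ᵇ b) ≡ false
≥⇒<ᵇ-false {a} {b} l with a <ᵇ b in eq
... | false = refl
... | true = ⊥-elim (<-irrefl refl (<-≤-trans (<ᵇ⇒< a b (≡true⇒T eq)) l))

armStartFrom≥ : ∀ o ls i → o ≤ armStartFrom o ls i
armStartFrom≥ o [] i = ≤-refl
armStartFrom≥ o (l ∷ ls) zero = ≤-refl
armStartFrom≥ o (l ∷ ls) (suc i) = ≤-trans (m≤m+n o l) (armStartFrom≥ (o + l) ls i)

armIndexFrom-spec : ∀ o ls w → o ≤ w → w < o + sum ls →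
  armIndexFrom o ls w < length ls × armStartFrom o ls (armIndexFrom o ls w) ≤ w × w < armStartFrom o ls (armIndexFrom o ls w) + at ls (armIndexFrom o ls w)
armIndexFrom-spec o [] w l1 l2 = ⊥-elim (<-irrefl refl (<-≤-trans l2 (≤-trans (≤-reflexive (+-identityʳ o)) l1)))
armIndexFrom-spec o (l ∷ ls) w l1 l2 with w <ᵇ o + l in eq
... | true = s≤s z≤n , l1 , <ᵇ⇒< w (o + l) (≡true⇒T eq)
... | false with armIndexFrom-spec (o + l) ls w (≮⇒≥ (λ lt → true≢false (trans (sym (<⇒<ᵇ-true lt)) eq))) (subst (w <_) (sym (+-assoc o l (sum ls))) l2)
... | a , b , c = s≤s a , b , c

armIndexFrom-unique : ∀ o ls i w → i < length ls → armStartFrom o ls i ≤ w → w < armStartFrom o ls i + at ls i → armIndexFrom o ls w ≡ i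
armIndexFrom-unique o (l ∷ ls) zero w _ l1 l2 rewrite <⇒<ᵇ-true l2 = refl
armIndexFrom-unique o (l ∷ ls) (suc i) w (s≤s li) l1 l2 rewrite ≥⇒<ᵇ-false {w} {o + l} (≤-trans (armStartFrom≥ (o + l) ls i) l1) =
  cong suc (armIndexFrom-unique (o + l) ls i w li l1 l2)

armEndFrom≤ : ∀ o ls i → i < length ls → armStartFrom o ls i + at ls i ≤ o + sum ls
armEndFrom≤ o (l ∷ ls) zero _ = +-monoʳ-≤ o (m≤m+n l (sum ls))
armEndFrom≤ o (l ∷ ls) (suc i) (s≤s li) = ≤-trans (armEndFrom≤ (o + l) ls i li) (≤-reflexive (+-assoc o l (sum ls)))

isEdge⇒∈ : ∀ es a b → isEdge es a b ≡ true → (a , b) ∈ es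
isEdge⇒∈ es a b e with any-true⁻ _ es e
... | (x , y) , m , e2 with ∧-true⁻ (x ≡ᵇ a) (y ≡ᵇ b) e2
... | e3 , e4 rewrite ≡ᵇ-true⁻ x a e3 | ≡ᵇ-true⁻ y b e4 = m

∈⇒isEdge : ∀ es a b → (a , b) ∈ es → isEdge es a b ≡ true
∈⇒isEdge es a b m = any-true⁺ (λ { (x , y) → (x ≡ᵇ a) ∧ (y ≡ᵇ b) }) es m (∧-true⁺ (≡ᵇ-refl a) (≡ᵇ-refl b))

∈-chain⁻ : ∀ o l a b → (a , b) ∈ chain o l → suc a ≡ b × o ≤ a × suc a ≤ o + l
∈-chain⁻ o (suc l) a b (here refl) = refl , ≤-refl , ≤-trans (≤-reflexive (+-comm 1 o)) (+-monoʳ-≤ o (s≤s z≤n))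
∈-chain⁻ o (suc l) a b (there m) with ∈-chain⁻ (suc o) l a b m
... | e , l1 , l2 = e , <⇒≤ l1 , subst (suc a ≤_) (sym (+-suc o l)) l2

∈-chain⁺ : ∀ o l a → o ≤ a → suc a ≤ o + l → (a , suc a) ∈ chain o l
∈-chain⁺ o zero a l1 l2 = ⊥-elim (<-irrefl refl (<-≤-trans (s≤s l1) (≤-trans l2 (≤-reflexive (+-identityʳ o)))))
∈-chain⁺ o (suc l) a l1 l2 with m≤n⇒m<n∨m≡n l1
... | inj₂ refl = here refl
... | inj₁ lt = there (∈-chain⁺ (suc o) l a lt (subst (suc a ≤_) (+-suc o l) l2))

StarAdjacent : ℕ → List ℕ → ℕ → ℕ → Set
StarAdjacent o ls a b = (a ≡ 0 × b ≡ armStartFrom o ls (armIndexFrom o ls b)) ⊎ (suc a ≡ b × armStartFrom o ls (armIndexFrom o ls b) ≤ a)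

∈-starEdges⁻ : ∀ o ls a b → (a , b) ∈ starEdges o ls → o ≤ b × b < o + sum ls × StarAdjacent o ls a b
∈-starEdges⁻ o (zero ∷ ls) a b m with ∈-starEdges⁻ (o + 0) ls a b m
... | l1 , l2 , adj rewrite ≥⇒<ᵇ-false {b} {o + 0} l1 =
  subst (_≤ b) (+-identityʳ o) l1 , subst (b <_) (+-assoc o 0 (sum ls)) l2 , adj
∈-starEdges⁻ o (suc l ∷ ls) a b m with ∈-++⁻ (pathEdges o (suc l)) m
... | inj₁ (here refl) rewrite <⇒<ᵇ-true {o} {o + suc l} (m<m+n o (s≤s z≤n)) =
  ≤-refl , m<m+n o (s≤s z≤n) , inj₁ (refl , refl)
... | inj₁ (there mc) with ∈-chain⁻ o l a b mc
... | refl , l1 , l2 rewrite <⇒<ᵇ-true {suc a} {o + suc l} (≤-<-trans l2 (+-monoʳ-< o (n<1+n l))) =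
  ≤-trans l1 (n≤1+n a) , <-≤-trans (≤-<-trans l2 (+-monoʳ-< o (n<1+n l))) (+-monoʳ-≤ o (m≤m+n (suc l) (sum ls))) , inj₂ (refl , l1)
∈-starEdges⁻ o (suc l ∷ ls) a b m | inj₂ mr with ∈-starEdges⁻ (o + suc l) ls a b mr
... | l1 , l2 , adj rewrite ≥⇒<ᵇ-false {b} {o + suc l} l1 =
  ≤-trans (m≤m+n o (suc l)) l1 , subst (b <_) (+-assoc o (suc l) (sum ls)) l2 , adj

hubEdge∈starEdges : ∀ o ls i → i < length ls → 1 ≤ at ls i → (0 , armStartFrom o ls i) ∈ starEdges o ls
hubEdge∈starEdges o (suc l ∷ ls) zero _ _ = here refl
hubEdge∈starEdges o (l ∷ ls) (suc i) (s≤s li) h = ∈-++⁺ʳ (pathEdges o l) (hubEdge∈starEdges (o + l) ls i li h)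

armEdge∈starEdges : ∀ o ls i w → i < length ls → armStartFrom o ls i ≤ w → suc w < armStartFrom o ls i + at ls i → (w , suc w) ∈ starEdges o ls
armEdge∈starEdges o (suc l ∷ ls) zero w _ l1 l2 = there (∈-++⁺ˡ (∈-chain⁺ o l w l1 (≤-pred (subst (suc (suc w) ≤_) (+-suc o l) l2))))
armEdge∈starEdges o (zero ∷ ls) zero w _ l1 l2 = ⊥-elim (<-irrefl refl (<-≤-trans l2 (≤-trans (≤-reflexive (+-identityʳ o)) (≤-trans l1 (n≤1+n w)))))
armEdge∈starEdges o (l ∷ ls) (suc i) w (s≤s li) l1 l2 = ∈-++⁺ʳ (pathEdges o l) (armEdge∈starEdges (o + l) ls i w li l1 l2)

≤⇒≤ᵇ-true : ∀ {a b} → a ≤ b → (a ≤ᵇ b) ≡ true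
≤⇒≤ᵇ-true l = T⇒≡true (≤⇒≤ᵇ l)

≤ᵇ-true⁻ : ∀ {a b} → (a ≤ᵇ b) ≡ true → a ≤ b
≤ᵇ-true⁻ {a} {b} e = ≤ᵇ⇒≤ a b (≡true⇒T e)

-- Chosen so that del (Star.pos ls α) X is definitionally Star.pos ls (without X α).
without : List ℕ → (ℕ → Bool) → (ℕ → Bool)
without X α w = α w ∧ not (w ∈ᵇ X)

module Star (ls : List ℕ) where
  N K : ℕ
  N = sum ls
  K = length ls

  es : List (ℕ × ℕ)
  es = starEdges 1 ls
  start : ℕ → ℕ
  start = armStartFrom 1 ls
  arm : ℕ → ℕ
  arm = armIndexFrom 1 ls
  len : ℕ → ℕ
  len = at ls

  -- The star with exactly the vertices in α present; star ls is pos (λ _ → true).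
  pos : (ℕ → Bool) → Position
  pos α = record { n = suc N ; edge = isEdge es ; alive = α }

  arm-spec : ∀ w → 1 ≤ w → w ≤ N → arm w < K × start (arm w) ≤ w × w < start (arm w) + len (arm w)
  arm-spec w l1 l2 = armIndexFrom-spec 1 ls w l1 (s≤s l2)

  start-arm≤ : ∀ w → 1 ≤ w → w ≤ N → start (arm w) ≤ w
  start-arm≤ w w1 wN = proj₁ (proj₂ (arm-spec w w1 wN))

  arm-unique : ∀ i w → i < K → start i ≤ w → w < start i + len i → arm w ≡ i
  arm-unique i w = armIndexFrom-unique 1 ls i w

  armEnd≤ : ∀ i → i < K → start i + len i ≤ suc N
  armEnd≤ i = armEndFrom≤ 1 ls i

  start≥1 : ∀ i → 1 ≤ start i
  start≥1 i = armStartFrom≥ 1 ls i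

  data Adjacent (u w : ℕ) : Set where
    hub→arm : u ≡ 0 → 1 ≤ w → w ≤ N → w ≡ start (arm w) → Adjacent u w
    arm→hub : w ≡ 0 → 1 ≤ u → u ≤ N → u ≡ start (arm u) → Adjacent u w
    forward : suc u ≡ w → 1 ≤ u → w ≤ N → arm u ≡ arm w → Adjacent u w
    backward : suc w ≡ u → 1 ≤ w → u ≤ N → arm u ≡ arm w → Adjacent u w

  starEdge⁻ : ∀ a b → isEdge es a b ≡ true →
     (a ≡ 0 × 1 ≤ b × b ≤ N × b ≡ start (arm b)) ⊎ (suc a ≡ b × 1 ≤ a × b ≤ N × arm a ≡ arm b)
  starEdge⁻ a b e with ∈-starEdges⁻ 1 ls a b (isEdge⇒∈ es a b e)
  ... | l1 , l2 , inj₁ (e₁ , e₂) = inj₁ (e₁ , l1 , ≤-pred l2 , e₂)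
  ... | l1 , l2 , inj₂ (refl , l3) with arm-spec b l1 (≤-pred l2)
  ... | q1 , q2 , q3 = inj₂ (refl , ≤-trans (start≥1 _) l3 , ≤-pred l2 ,
          arm-unique (arm b) a q1 l3 (<-trans (n<1+n a) q3))

  E⇒Adjacent : ∀ α u w → E (pos α) u w ≡ true → Adjacent u w
  E⇒Adjacent α u w e with E-true⁻ (pos α) u w e
  ... | _ , _ , ee , _ with ∨-true⁻ (isEdge es u w) (isEdge es w u) ee
  ... | inj₁ e₁ with starEdge⁻ u w e₁
  ...   | inj₁ (a , b , c , d) = hub→arm a b c d
  ...   | inj₂ (a , b , c , d) = forward a b c d
  E⇒Adjacent α u w e | _ , _ , ee , _ | inj₂ e₂ with starEdge⁻ w u e₂
  ...   | inj₁ (a , b , c , d) = arm→hub a b c d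
  ...   | inj₂ (a , b , c , d) = backward a b c (sym d)

  edgesBounded : ∀ α → EdgesBounded (pos α)
  edgesBounded α u w e with E⇒Adjacent α u w e
  ... | hub→arm refl l1 l2 _ = s≤s z≤n , s≤s l2
  ... | arm→hub refl l1 l2 _ = s≤s l2 , s≤s z≤n
  ... | forward refl l1 l2 _ = s≤s (≤-trans (n≤1+n u) l2) , s≤s l2
  ... | backward refl l1 l2 _ = s≤s l2 , s≤s (≤-trans (n≤1+n w) l2)

  hub-edge : ∀ α i → i < K → 1 ≤ len i → α 0 ≡ true → α (start i) ≡ true → E (pos α) 0 (start i) ≡ true
  hub-edge α i li l a0 a1 = E-true⁺ (pos α) 0 (start i) a0 a1 (∨-trueˡ⁺ _ (∈⇒isEdge es 0 (start i) (hubEdge∈starEdges 1 ls i li l)))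
    (λ e → <-irrefl e (start≥1 i))

  arm-edge : ∀ α i w → i < K → start i ≤ w → suc w < start i + len i → α w ≡ true → α (suc w) ≡ true → E (pos α) w (suc w) ≡ true
  arm-edge α i w li l1 l2 a0 a1 = E-true⁺ (pos α) w (suc w) a0 a1 (∨-trueˡ⁺ _ (∈⇒isEdge es w (suc w) (armEdge∈starEdges 1 ls i w li l1 l2)))
    (λ e → <-irrefl e (n<1+n w))

  tailSet : ℕ → ℕ → ℕ → Bool
  tailSet i t u = (1 ≤ᵇ u) ∧ ((u ≤ᵇ N) ∧ ((arm u ≡ᵇ i) ∧ (t ≤ᵇ u)))

  tailSet-true⁺ : ∀ i t u → 1 ≤ u → u ≤ N → arm u ≡ i → t ≤ u → tailSet i t u ≡ true
  tailSet-true⁺ i t u a b refl d rewrite ≤⇒≤ᵇ-true a | ≤⇒≤ᵇ-true b | ≡ᵇ-refl (arm u) | ≤⇒≤ᵇ-true d = refl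

  tailSet-true⁻ : ∀ i t u → tailSet i t u ≡ true → 1 ≤ u × u ≤ N × arm u ≡ i × t ≤ u
  tailSet-true⁻ i t u e with ∧-true⁻ (1 ≤ᵇ u) _ e
  ... | a , e' with ∧-true⁻ (u ≤ᵇ N) _ e'
  ... | b , e'' with ∧-true⁻ (arm u ≡ᵇ i) _ e''
  ... | c , d = ≤ᵇ-true⁻ a , ≤ᵇ-true⁻ b , ≡ᵇ-true⁻ _ _ c , ≤ᵇ-true⁻ d

  tailSet-false⁺ : ∀ i t u → (tailSet i t u ≡ true → ⊥) → tailSet i t u ≡ false
  tailSet-false⁺ i t u h with tailSet i t u
  ... | true = ⊥-elim (h refl)
  ... | false = refl

  TailCut : (ℕ → Bool) → ℕ → ℕ → Set
  TailCut α i t = arm t ≡ i × 1 ≤ t × t ≤ N × (t ≡ start i → α 0 ≡ false) × (start i < t → α (pred t) ≡ false)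

  tailSet-closed : ∀ α i t → TailCut α i t → Closed (pos α) (tailSet i t)
  tailSet-closed α i t (ht , t1 , tN , h0 , hp) u w cu e with tailSet-true⁻ i t u cu | E-true⁻ (pos α) u w e
  ... | u1 , uN , ui , tu | au , aw , _ with E⇒Adjacent α u w e
  ... | hub→arm refl _ _ _ = ⊥-elim (<-irrefl refl u1)
  ... | arm→hub refl _ _ ue = ⊥-elim (true≢false (trans (sym aw) (h0 t≡)))
    where
    t≡ : t ≡ start i
    t≡ = ≤-antisym (≤-trans tu (≤-reflexive (trans ue (cong start ui)))) (subst (λ z → start z ≤ t) ht (start-arm≤ t t1 tN))
  ... | forward refl _ wN ea = tailSet-true⁺ i t w (s≤s z≤n) wN (trans (sym ea) ui) (≤-trans tu (n≤1+n u))
  ... | backward refl w1 _ ea with t ≤? w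
  ...   | yes tw = tailSet-true⁺ i t w w1 (≤-trans (n≤1+n w) uN) (trans (sym ea) ui) tw
  ...   | no ntw = ⊥-elim (true≢false (trans (sym aw) (subst (λ z → α (pred z) ≡ false) t≡ (hp lt))))
    where
    t≡ : t ≡ suc w
    t≡ = ≤-antisym tu (≰⇒> ntw)
    lt : start i < t
    lt = subst (_< t) (cong start (trans (sym ea) ui)) (<-≤-trans (s≤s (start-arm≤ w w1 (≤-trans (n≤1+n w) uN))) (≤-reflexive (sym t≡)))

  Connected : (ℕ → Bool) → Set
  Connected α = ∀ v w → v ≤ N → w ≤ N → α v ≡ true → α w ≡ true → reach (pos α) v w ≡ true

  cut⇒illegal : ∀ α → Connected α → ∀ x X i t w → TailCut (without (x ∷ X) α) i t →
     x ≤ N → α x ≡ true → α t ≡ true → (t ∈ᵇ (x ∷ X)) ≡ false →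
     w ≤ N → α w ≡ true → (w ∈ᵇ (x ∷ X)) ≡ false → tailSet i t w ≡ false → legal (pos α) (x ∷ X) ≡ true → ⊥
  cut⇒illegal α conn x X i t w cut@(ti , t1 , tN , _ , _) xN ax at t∉X wN aw w∉X w∉tail lg =
    true≢false (trans (sym (reach-closed (pos α′) (tailSet i t) (tailSet-closed α′ i t cut) t (tailSet-true⁺ i t t t1 tN ti ≤-refl) w
       (legal⁻ (pos α) x X lg t w (s≤s tN) (s≤s wN) (conn x t xN tN ax at) (conn x w xN wN ax aw) t∉X w∉X))) w∉tail)
    where
    α′ : ℕ → Bool
    α′ = without (x ∷ X) α

  walks⇒Connected : ∀ α h → (∀ w → w ≤ N → α w ≡ true → Walk (pos α) h w) → Connected α
  walks⇒Connected α h hw v w lv lw av aw = walk⇒reach (pos α) (edgesBounded α) av (s≤s lv) (reverseʷ (hw v lv av) ++ʷ hw w lw aw)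

  segment-walk : ∀ α i x B → i < K → start i ≤ x → B ≤ start i + len i → (∀ u → x ≤ u → u < B → α u ≡ true) →
     ∀ d → x + d < B → Walk (pos α) x (x + d)
  segment-walk α i x B li lx lB h zero lt = subst (Walk (pos α) x) (sym (+-identityʳ x)) []
  segment-walk α i x B li lx lB h (suc d) lt =
     subst (Walk (pos α) x) (sym (+-suc x d))
       (_∷ʳʷ_ (segment-walk α i x B li lx lB h d (<-trans (+-monoʳ-< x (n<1+n d)) lt))
          (arm-edge α i (x + d) li (≤-trans lx (m≤m+n _ _)) (≤-trans (≤-reflexive (cong suc (sym (+-suc x d)))) (<-≤-trans lt lB))
             (h _ (m≤m+n _ _) (<-trans (+-monoʳ-< x (n<1+n d)) lt))
             (subst (λ z → α z ≡ true) (+-suc x d) (h _ (m≤m+n _ _) lt))))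

  hub-walk : ∀ α i B → i < K → B ≤ start i + len i → α 0 ≡ true → (∀ u → start i ≤ u → u < B → α u ≡ true) →
     ∀ d → start i + d < B → Walk (pos α) 0 (start i + d)
  hub-walk α i B li lB a0 h d lt =
    hub-edge α i li 1≤len a0 (h (start i) ≤-refl start<B) ∷ segment-walk α i (start i) B li ≤-refl lB h d lt
    where
    start<B : start i < B
    start<B = ≤-<-trans (m≤m+n (start i) d) lt
    1≤len : 1 ≤ len i
    1≤len = +-cancelˡ-≤ (start i) 1 (len i) (≤-trans (≤-reflexive (+-comm (start i) 1)) (<-≤-trans start<B lB))

-- Arm lengths and the value recursion

mod3 : ℕ → ℕ
mod3 zero = 0
mod3 (suc zero) = 1
mod3 (suc (suc zero)) = 2
mod3 (suc (suc (suc k))) = mod3 k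

mod3-2+≢ : ∀ k → mod3 (suc (suc k)) ≢ mod3 k
mod3-2+≢ zero ()
mod3-2+≢ (suc zero) ()
mod3-2+≢ (suc (suc zero)) ()
mod3-2+≢ (suc (suc (suc k))) = mod3-2+≢ k

mod3-1+≢ : ∀ k → mod3 (suc k) ≢ mod3 k
mod3-1+≢ zero ()
mod3-1+≢ (suc zero) ()
mod3-1+≢ (suc (suc zero)) ()
mod3-1+≢ (suc (suc (suc k))) = mod3-1+≢ k

<mod3-2+ : ∀ k j → j < mod3 (suc (suc k)) → j ≡ mod3 k ⊎ j ≡ mod3 (suc k)
<mod3-2+ zero zero _ = inj₁ refl
<mod3-2+ zero (suc zero) _ = inj₂ refl
<mod3-2+ zero (suc (suc j)) (s≤s (s≤s ()))
<mod3-2+ (suc zero) j ()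
<mod3-2+ (suc (suc zero)) zero _ = inj₂ refl
<mod3-2+ (suc (suc zero)) (suc j) (s≤s ())
<mod3-2+ (suc (suc (suc k))) j l = <mod3-2+ k j l

mod3-small : ∀ a → a < 3 → mod3 a ≡ a
mod3-small zero _ = refl
mod3-small (suc zero) _ = refl
mod3-small (suc (suc zero)) _ = refl
mod3-small (suc (suc (suc a))) (s≤s (s≤s (s≤s ())))

mod3-∸3 : ∀ a → 3 ≤ a → mod3 (a ∸ 3) ≡ mod3 a
mod3-∸3 (suc (suc (suc a))) _ = refl
mod3-∸3 (suc zero) (s≤s ())
mod3-∸3 (suc (suc zero)) (s≤s (s≤s ()))

mod3≤ : ∀ x → mod3 x ≤ x
mod3≤ zero = z≤n
mod3≤ (suc zero) = ≤-refl
mod3≤ (suc (suc zero)) = ≤-refl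
mod3≤ (suc (suc (suc x))) = ≤-trans (mod3≤ x) (m≤n+m x 3)

<mod3-covered : ∀ m vs → (∀ m₁ → suc m₁ ≡ m → mod3 m₁ ∈ vs) → (∀ m₂ → suc (suc m₂) ≡ m → mod3 m₂ < mod3 m → mod3 m₂ ∈ vs) →
   ∀ j → j < mod3 m → j ∈ vs
<mod3-covered (suc zero) vs one-less two-less zero lj = one-less 0 refl
<mod3-covered (suc zero) vs one-less two-less (suc j) (s≤s ())
<mod3-covered (suc (suc k)) vs one-less two-less j lj with <mod3-2+ k j lj
... | inj₁ refl = two-less k refl lj
... | inj₂ refl = one-less (suc k) refl

-- The value of a path on m vertices: its options are the paths on m - 1 and m - 2 vertices.
mex≡mod3 : ∀ m vs → (∀ v → v ∈ vs → ∃ λ m′ → v ≡ mod3 m′ × (suc m′ ≡ m ⊎ suc (suc m′) ≡ m)) →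
   (∀ m₁ → suc m₁ ≡ m → mod3 m₁ ∈ vs) → (∀ m₂ → suc (suc m₂) ≡ m → mod3 m₂ < mod3 m → mod3 m₂ ∈ vs) → mex vs ≡ mod3 m
mex≡mod3 m vs options-of-path one-less two-less = mex-unique vs (mod3 m) absent (<mod3-covered m vs one-less two-less)
  where
  absent : ∀ v → v ∈ vs → v ≢ mod3 m
  absent v mv with options-of-path v mv
  ... | m′ , refl , inj₁ refl = λ e → mod3-1+≢ m′ (sym e)
  ... | m′ , refl , inj₂ refl = λ e → mod3-2+≢ m′ (sym e)

signum : ℕ → ℕ
signum zero = 0
signum (suc _) = 1

countPositive : List ℕ → ℕ
countPositive [] = 0
countPositive (x ∷ xs) = signum x + countPositive xs

modifyAt : List ℕ → ℕ → (ℕ → ℕ) → List ℕ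
modifyAt [] i g = []
modifyAt (x ∷ xs) zero g = g x ∷ xs
modifyAt (x ∷ xs) (suc i) g = x ∷ modifyAt xs i g

shortenHead : ℕ → List ℕ → List (List ℕ)
shortenHead zero as = []
shortenHead (suc zero) as = (0 ∷ as) ∷ []
shortenHead (suc (suc a)) as = (suc a ∷ as) ∷ (a ∷ as) ∷ []

shortenings : List ℕ → List (List ℕ)
shortenings [] = []
shortenings (a ∷ as) = shortenHead a as ++ map (a ∷_) (shortenings as)

-- The Grundy value of the subdivided star with arm lengths as, computed with fuel.  With at most
-- two nonempty arms the star is a path on 1 + sum as vertices; otherwise every legal move
-- shortens one arm by one or two vertices.
starValue : ℕ → List ℕ → ℕ
starValue zero as = 0
starValue (suc f) as = if countPositive as ≤ᵇ 2 then mod3 (suc (sum as)) else mex (map (starValue f) (shortenings as))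

at-modifyAt-same : ∀ as i g → i < length as → at (modifyAt as i g) i ≡ g (at as i)
at-modifyAt-same (x ∷ as) zero g _ = refl
at-modifyAt-same (x ∷ as) (suc i) g (s≤s l) = at-modifyAt-same as i g l

at-modifyAt-other : ∀ as i j g → i ≢ j → at (modifyAt as i g) j ≡ at as j
at-modifyAt-other [] i j g ne = refl
at-modifyAt-other (x ∷ as) zero zero g ne = ⊥-elim (ne refl)
at-modifyAt-other (x ∷ as) zero (suc j) g ne = refl
at-modifyAt-other (x ∷ as) (suc i) zero g ne = refl
at-modifyAt-other (x ∷ as) (suc i) (suc j) g ne = at-modifyAt-other as i j g (ne ∘ cong suc)

at-modifyAt-≤ : ∀ as i g j → (∀ x → g x ≤ x) → at (modifyAt as i g) j ≤ at as j
at-modifyAt-≤ [] i g j h = z≤n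
at-modifyAt-≤ (x ∷ as) zero g zero h = h x
at-modifyAt-≤ (x ∷ as) zero g (suc j) h = ≤-refl
at-modifyAt-≤ (x ∷ as) (suc i) g zero h = ≤-refl
at-modifyAt-≤ (x ∷ as) (suc i) g (suc j) h = at-modifyAt-≤ as i g j h

at-≥length : ∀ as j → length as ≤ j → at as j ≡ 0
at-≥length [] j _ = refl
at-≥length (x ∷ as) (suc j) (s≤s l) = at-≥length as j l

length-modifyAt : ∀ as i g → length (modifyAt as i g) ≡ length as
length-modifyAt [] i g = refl
length-modifyAt (x ∷ as) zero g = refl
length-modifyAt (x ∷ as) (suc i) g = cong suc (length-modifyAt as i g)

<length-modifyAt : ∀ as i g {j} → j < length as → j < length (modifyAt as i g)
<length-modifyAt as i g = subst (_ <_) (sym (length-modifyAt as i g))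

modifyAt-comm : ∀ as i j g h → i ≢ j → modifyAt (modifyAt as i g) j h ≡ modifyAt (modifyAt as j h) i g
modifyAt-comm [] i j g h ne = refl
modifyAt-comm (x ∷ as) zero zero g h ne = ⊥-elim (ne refl)
modifyAt-comm (x ∷ as) zero (suc j) g h ne = refl
modifyAt-comm (x ∷ as) (suc i) zero g h ne = refl
modifyAt-comm (x ∷ as) (suc i) (suc j) g h ne = cong (x ∷_) (modifyAt-comm as i j g h (ne ∘ cong suc))

modifyAt-∘ : ∀ as i g h → modifyAt (modifyAt as i g) i h ≡ modifyAt as i (h ∘ g)
modifyAt-∘ [] i g h = refl
modifyAt-∘ (x ∷ as) zero g h = refl
modifyAt-∘ (x ∷ as) (suc i) g h = cong (x ∷_) (modifyAt-∘ as i g h)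

modifyAt-cong : ∀ as i g h → g (at as i) ≡ h (at as i) → modifyAt as i g ≡ modifyAt as i h
modifyAt-cong [] i g h e = refl
modifyAt-cong (x ∷ as) zero g h e = cong (_∷ as) e
modifyAt-cong (x ∷ as) (suc i) g h e = cong (x ∷_) (modifyAt-cong as i g h e)

modifyAt-id : ∀ as i g → g (at as i) ≡ at as i → modifyAt as i g ≡ as
modifyAt-id [] i g e = refl
modifyAt-id (x ∷ as) zero g e = cong (_∷ as) e
modifyAt-id (x ∷ as) (suc i) g e = cong (x ∷_) (modifyAt-id as i g e)

modifyAt-++-length : ∀ pre l ls g → modifyAt (pre ++ l ∷ ls) (length pre) g ≡ pre ++ g l ∷ ls
modifyAt-++-length [] l ls g = refl
modifyAt-++-length (x ∷ pre) l ls g = cong (x ∷_) (modifyAt-++-length pre l ls g)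

at-++-length : ∀ pre l ls → at (pre ++ l ∷ ls) (length pre) ≡ l
at-++-length [] l ls = refl
at-++-length (x ∷ pre) l ls = at-++-length pre l ls

length<length-++∷ : ∀ (pre : List ℕ) l ls → length pre < length (pre ++ l ∷ ls)
length<length-++∷ [] l ls = s≤s z≤n
length<length-++∷ (x ∷ pre) l ls = s≤s (length<length-++∷ pre l ls)

sum-modifyAt : ∀ as i g → i < length as → sum (modifyAt as i g) + at as i ≡ g (at as i) + sum as
sum-modifyAt (x ∷ as) zero g _ = trans (+-assoc (g x) (sum as) x) (cong (g x +_) (+-comm (sum as) x))
sum-modifyAt (x ∷ as) (suc i) g (s≤s l) = begin
  x + sum (modifyAt as i g) + at as i  ≡⟨ +-assoc x _ _ ⟩
  x + (sum (modifyAt as i g) + at as i) ≡⟨ cong (x +_) (sum-modifyAt as i g l) ⟩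
  x + (g (at as i) + sum as)            ≡⟨ x+[y+z]≡y+[x+z] x (g (at as i)) (sum as) ⟩
  g (at as i) + (x + sum as)            ∎
  where
  open ≡-Reasoning
  x+[y+z]≡y+[x+z] : ∀ x y z → x + (y + z) ≡ y + (x + z)
  x+[y+z]≡y+[x+z] x y z = trans (sym (+-assoc x y z)) (trans (cong (_+ z) (+-comm x y)) (+-assoc y x z))

sum-modifyAt-shorter : ∀ as i g k → i < length as → k + g (at as i) ≡ at as i → k + sum (modifyAt as i g) ≡ sum as
sum-modifyAt-shorter as i g k l e = +-cancelˡ-≡ (g (at as i)) _ _ (begin
  g (at as i) + (k + sum (modifyAt as i g)) ≡⟨ rotate (g (at as i)) k _ ⟩
  sum (modifyAt as i g) + (k + g (at as i)) ≡⟨ cong (sum (modifyAt as i g) +_) e ⟩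
  sum (modifyAt as i g) + at as i           ≡⟨ sum-modifyAt as i g l ⟩
  g (at as i) + sum as                       ∎)
  where
  open ≡-Reasoning
  rotate : ∀ a b c → a + (b + c) ≡ c + (b + a)
  rotate a b c = trans (+-comm a (b + c)) (trans (+-assoc b c a) (trans (+-comm b (c + a)) (trans (+-assoc c a b) (cong (c +_) (+-comm a b)))))

sum-modifyAt-≤ : ∀ as i g → (∀ x → g x ≤ x) → sum (modifyAt as i g) ≤ sum as
sum-modifyAt-≤ [] i g h = z≤n
sum-modifyAt-≤ (x ∷ as) zero g h = +-monoˡ-≤ (sum as) (h x)
sum-modifyAt-≤ (x ∷ as) (suc i) g h = +-monoʳ-≤ x (sum-modifyAt-≤ as i g h)

pred²≤ : ∀ a → pred (pred a) ≤ a
pred²≤ a = ≤-trans pred[n]≤n pred[n]≤n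

+-pred-end : ∀ s a → 1 ≤ a → suc (s + pred a) ≡ s + a
+-pred-end s (suc a) _ = sym (+-suc s a)

+-pred²-end : ∀ s a → 2 ≤ a → suc (suc (s + pred (pred a))) ≡ s + a
+-pred²-end s (suc (suc a)) _ = sym (trans (+-suc s (suc a)) (cong suc (+-suc s a)))
+-pred²-end s (suc zero) (s≤s ())

sum-shorten₁ : ∀ as i → i < length as → 1 ≤ at as i → suc (sum (modifyAt as i pred)) ≡ sum as
sum-shorten₁ as i l p = sum-modifyAt-shorter as i pred 1 l (+-pred-end 0 (at as i) p)

sum-shorten₂ : ∀ as i → i < length as → 2 ≤ at as i → suc (suc (sum (modifyAt as i (pred ∘ pred)))) ≡ sum as
sum-shorten₂ as i l p = sum-modifyAt-shorter as i (pred ∘ pred) 2 l (+-pred²-end 0 (at as i) p)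

sum-shorten₃ : ∀ as i → i < length as → 3 ≤ at as i → 3 + sum (modifyAt as i (_∸ 3)) ≡ sum as
sum-shorten₃ as i l p = sum-modifyAt-shorter as i (_∸ 3) 3 l (m+[n∸m]≡n p)

countPositive-modifyAt : ∀ as i g → i < length as →
  countPositive (modifyAt as i g) + signum (at as i) ≡ signum (g (at as i)) + countPositive as
countPositive-modifyAt (x ∷ as) zero g _ =
  trans (+-assoc (signum (g x)) (countPositive as) (signum x)) (cong (signum (g x) +_) (+-comm (countPositive as) (signum x)))
countPositive-modifyAt (x ∷ as) (suc i) g (s≤s l) = begin
  signum x + countPositive (modifyAt as i g) + signum (at as i)   ≡⟨ +-assoc (signum x) _ _ ⟩
  signum x + (countPositive (modifyAt as i g) + signum (at as i)) ≡⟨ cong (signum x +_) (countPositive-modifyAt as i g l) ⟩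
  signum x + (signum (g (at as i)) + countPositive as)            ≡⟨ sym (+-assoc (signum x) _ _) ⟩
  signum x + signum (g (at as i)) + countPositive as              ≡⟨ cong (_+ countPositive as) (+-comm (signum x) _) ⟩
  signum (g (at as i)) + signum x + countPositive as              ≡⟨ +-assoc (signum (g (at as i))) _ _ ⟩
  signum (g (at as i)) + (signum x + countPositive as)            ∎
  where open ≡-Reasoning

signum-mono : ∀ a b → b ≤ a → signum b ≤ signum a
signum-mono a zero _ = z≤n
signum-mono (suc a) (suc b) _ = ≤-refl

countPositive-modifyAt-≤ : ∀ as i g → i < length as → g (at as i) ≤ at as i → countPositive (modifyAt as i g) ≤ countPositive as
countPositive-modifyAt-≤ as i g l h = +-cancelʳ-≤ (signum (at as i)) _ _
  (≤-trans (≤-reflexive (countPositive-modifyAt as i g l))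
    (≤-trans (+-monoˡ-≤ (countPositive as) (signum-mono _ _ h)) (≤-reflexive (+-comm (signum (at as i)) (countPositive as)))))

countPositive≤sum : ∀ as → countPositive as ≤ sum as
countPositive≤sum [] = z≤n
countPositive≤sum (zero ∷ as) = countPositive≤sum as
countPositive≤sum (suc x ∷ as) = s≤s (≤-trans (countPositive≤sum as) (m≤n+m (sum as) x))

positive-arm : ∀ as → 1 ≤ sum as → ∃ λ i → i < length as × 1 ≤ at as i
positive-arm (zero ∷ as) l with positive-arm as l
... | i , a , b = suc i , s≤s a , b
positive-arm (suc x ∷ as) l = zero , s≤s z≤n , s≤s z≤n

long-arm : ∀ as → countPositive as < sum as → ∃ λ i → i < length as × 2 ≤ at as i
long-arm (zero ∷ as) l with long-arm as l
... | i , a , b = suc i , s≤s a , b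
long-arm (suc zero ∷ as) (s≤s l) with long-arm as l
... | i , a , b = suc i , s≤s a , b
long-arm (suc (suc x) ∷ as) l = zero , s≤s z≤n , s≤s (s≤s z≤n)

const0 : ℕ → ℕ
const0 _ = 0

positive⇒countPositive>0 : ∀ as j → 1 ≤ at as j → 1 ≤ countPositive as
positive⇒countPositive>0 (suc x ∷ as) zero _ = s≤s z≤n
positive⇒countPositive>0 (x ∷ as) (suc j) p = ≤-trans (positive⇒countPositive>0 as j p) (m≤n+m (countPositive as) (signum x))

countPositive>0⇒positive : ∀ as → 1 ≤ countPositive as → ∃ λ i → i < length as × 1 ≤ at as i
countPositive>0⇒positive (zero ∷ as) l with countPositive>0⇒positive as l
... | i , a , b = suc i , s≤s a , b
countPositive>0⇒positive (suc x ∷ as) l = zero , s≤s z≤n , s≤s z≤n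

countPositive-zeroAt : ∀ as i → i < length as → 1 ≤ at as i → suc (countPositive (modifyAt as i const0)) ≡ countPositive as
countPositive-zeroAt as i l p with at as i | countPositive-modifyAt as i const0 l
... | suc a | e = trans (+-comm 1 _) e

positive-elsewhere : ∀ as i j → i ≢ j → 1 ≤ at as j → 1 ≤ at (modifyAt as i const0) j
positive-elsewhere as i j ne = subst (1 ≤_) (sym (at-modifyAt-other as i j const0 ne))

two-positive⇒2≤countPositive : ∀ as i j → i ≢ j → i < length as → 1 ≤ at as i → 1 ≤ at as j → 2 ≤ countPositive as
two-positive⇒2≤countPositive as i j ne li pi pj =
  ≤-trans (s≤s (positive⇒countPositive>0 (modifyAt as i const0) j (positive-elsewhere as i j ne pj))) (≤-reflexive (countPositive-zeroAt as i li pi))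

three-positive⇒3≤countPositive : ∀ as i j k → i ≢ j → i ≢ k → j ≢ k → i < length as → j < length as →
   1 ≤ at as i → 1 ≤ at as j → 1 ≤ at as k → 3 ≤ countPositive as
three-positive⇒3≤countPositive as i j k nij nik njk li lj pi pj pk =
  ≤-trans (s≤s (two-positive⇒2≤countPositive (modifyAt as i const0) j k njk (<length-modifyAt as i const0 lj)
             (positive-elsewhere as i j nij pj) (positive-elsewhere as i k nik pk)))
    (≤-reflexive (countPositive-zeroAt as i li pi))

another-positive : ∀ as → 2 ≤ countPositive as → ∀ i → ∃ λ j → j ≢ i × j < length as × 1 ≤ at as j
another-positive as l i with i <? length as
... | no ni with countPositive>0⇒positive as (≤-trans (s≤s z≤n) l)
...   | j , lj , pj = j , (λ { refl → ni lj }) , lj , pj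
another-positive as l i | yes li with at as i in ea
... | zero with countPositive>0⇒positive as (≤-trans (s≤s z≤n) l)
...   | j , lj , pj = j , (λ { refl → ≤⇒≯ (≤-reflexive ea) pj }) , lj , pj
another-positive as l i | yes li | suc a
  with countPositive>0⇒positive (modifyAt as i const0) (≤-pred (≤-trans l (≤-reflexive (sym (countPositive-zeroAt as i li (subst (1 ≤_) (sym ea) (s≤s z≤n)))))))
... | j , lj , pj with j ≟ i
... | yes refl = ⊥-elim (≤⇒≯ (≤-reflexive (at-modifyAt-same as i const0 li)) pj)
... | no nji = j , nji , subst (j <_) (length-modifyAt as i const0) lj , subst (1 ≤_) (at-modifyAt-other as i j const0 (nji ∘ sym)) pj

two-other-positives : ∀ as → 3 ≤ countPositive as → ∀ i → ∃ λ j → ∃ λ k → j ≢ i × k ≢ i × j ≢ k ×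
  j < length as × k < length as × 1 ≤ at as j × 1 ≤ at as k
two-other-positives as l i with another-positive as (≤-trans (s≤s (s≤s z≤n)) l) i
... | j , nji , lj , pj with another-positive (modifyAt as j const0) (≤-pred (≤-trans l (≤-reflexive (sym (countPositive-zeroAt as j lj pj))))) i
... | k , nki , lk , pk with k ≟ j
... | yes refl = ⊥-elim (≤⇒≯ (≤-reflexive (at-modifyAt-same as k const0 lj)) pk)
... | no nkj = j , k , nji , nki , nkj ∘ sym , lj , subst (k <_) (length-modifyAt as j const0) lk ,
        pj , subst (1 ≤_) (at-modifyAt-other as j k const0 (nkj ∘ sym)) pk

sole-positive : ∀ as i → countPositive as ≤ 1 → i < length as → 1 ≤ at as i → ∀ j → j ≢ i → at as j ≡ 0
sole-positive as i l li pi j nji with at as j in ea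
... | zero = refl
... | suc a = ⊥-elim (≤⇒≯ l (two-positive⇒2≤countPositive as i j (nji ∘ sym) li pi (subst (1 ≤_) (sym ea) (s≤s z≤n))))

countPositive≡0⇒zero : ∀ as → countPositive as ≡ 0 → ∀ j → at as j ≡ 0
countPositive≡0⇒zero [] e j = refl
countPositive≡0⇒zero (zero ∷ as) e zero = refl
countPositive≡0⇒zero (zero ∷ as) e (suc j) = countPositive≡0⇒zero as e j

sum≡0⇒zero : ∀ as → sum as ≡ 0 → ∀ j → at as j ≡ 0
sum≡0⇒zero [] e j = refl
sum≡0⇒zero (zero ∷ as) e zero = refl
sum≡0⇒zero (zero ∷ as) e (suc j) = sum≡0⇒zero as e j

all-zero⇒sum≡0 : ∀ as → (∀ j → at as j ≡ 0) → sum as ≡ 0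
all-zero⇒sum≡0 [] h = refl
all-zero⇒sum≡0 (x ∷ as) h rewrite h 0 = all-zero⇒sum≡0 as (λ j → h (suc j))

sum-sole-positive : ∀ as i → i < length as → (∀ j → j ≢ i → at as j ≡ 0) → sum as ≡ at as i
sum-sole-positive as i li h = trans (sym (sum-modifyAt as i const0 li)) (cong (_+ at as i) rest≡0)
  where
  rest≡0 : sum (modifyAt as i const0) ≡ 0
  rest≡0 = all-zero⇒sum≡0 (modifyAt as i const0) zeroed
    where
    zeroed : ∀ j → at (modifyAt as i const0) j ≡ 0
    zeroed j with j ≟ i
    ... | yes refl = at-modifyAt-same as j const0 li
    ... | no ne = trans (at-modifyAt-other as i j const0 (ne ∘ sym)) (h j ne)

sum-two-positive : ∀ as i k → i ≢ k → i < length as → k < length as → (∀ j → j ≢ i → j ≢ k → at as j ≡ 0) →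
  sum as ≡ at as i + at as k
sum-two-positive as i k nik li lk h =
  trans (sym (sum-modifyAt as i const0 li)) (trans (cong (_+ at as i) sum-rest) (+-comm (at as k) (at as i)))
  where
  rest : List ℕ
  rest = modifyAt as i const0
  sum-rest : sum rest ≡ at as k
  sum-rest = trans (sum-sole-positive rest k (<length-modifyAt as i const0 lk) zeroed) (at-modifyAt-other as i k const0 nik)
    where
    zeroed : ∀ j → j ≢ k → at rest j ≡ 0
    zeroed j njk with j ≟ i
    ... | yes refl = at-modifyAt-same as j const0 li
    ... | no nji = trans (at-modifyAt-other as i j const0 (nji ∘ sym)) (h j nji njk)

IsShortening : List ℕ → List ℕ → Set
IsShortening as y = ∃ λ i → i < length as ×
  ((1 ≤ at as i × y ≡ modifyAt as i pred) ⊎ (2 ≤ at as i × y ≡ modifyAt as i (pred ∘ pred)))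

shortenings⁻ : ∀ as y → y ∈ shortenings as → IsShortening as y
shortenings⁻ (a ∷ as) y m with ∈-++⁻ (shortenHead a as) m
shortenings⁻ (suc zero ∷ as) y m | inj₁ (here refl) = zero , s≤s z≤n , inj₁ (≤-refl , refl)
shortenings⁻ (suc (suc a) ∷ as) y m | inj₁ (here refl) = zero , s≤s z≤n , inj₁ (s≤s z≤n , refl)
shortenings⁻ (suc (suc a) ∷ as) y m | inj₁ (there (here refl)) = zero , s≤s z≤n , inj₂ (s≤s (s≤s z≤n) , refl)
... | inj₂ m₂ with ∈-map⁻ (a ∷_) m₂
... | z , mz , refl with shortenings⁻ as z mz
... | i , l , inj₁ (p , refl) = suc i , s≤s l , inj₁ (p , refl)
... | i , l , inj₂ (p , refl) = suc i , s≤s l , inj₂ (p , refl)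

shorten₁∈shortenings : ∀ as i → i < length as → 1 ≤ at as i → modifyAt as i pred ∈ shortenings as
shorten₁∈shortenings (suc zero ∷ as) zero _ _ = here refl
shorten₁∈shortenings (suc (suc a) ∷ as) zero _ _ = here refl
shorten₁∈shortenings (a ∷ as) (suc i) (s≤s l) p = ∈-++⁺ʳ (shortenHead a as) (∈-map⁺ (a ∷_) (shorten₁∈shortenings as i l p))

shorten₂∈shortenings : ∀ as i → i < length as → 2 ≤ at as i → modifyAt as i (pred ∘ pred) ∈ shortenings as
shorten₂∈shortenings (suc zero ∷ as) zero _ (s≤s ())
shorten₂∈shortenings (suc (suc a) ∷ as) zero _ _ = there (here refl)
shorten₂∈shortenings (a ∷ as) (suc i) (s≤s l) p = ∈-++⁺ʳ (shortenHead a as) (∈-map⁺ (a ∷_) (shorten₂∈shortenings as i l p))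

sum-shortening< : ∀ as y → y ∈ shortenings as → sum y < sum as
sum-shortening< as y m with shortenings⁻ as y m
... | i , l , inj₁ (p , refl) = ≤-reflexive (sum-shorten₁ as i l p)
... | i , l , inj₂ (p , refl) = ≤-trans (n≤1+n _) (≤-reflexive (sum-shorten₂ as i l p))

starValue-path : ∀ F as → countPositive as ≤ 2 → starValue (suc F) as ≡ mod3 (suc (sum as))
starValue-path F as l rewrite T⇒≡true (≤⇒≤ᵇ l) = refl

starValue-branching : ∀ F as → 3 ≤ countPositive as → starValue (suc F) as ≡ mex (map (starValue F) (shortenings as))
starValue-branching F as l with countPositive as ≤ᵇ 2 in eq
... | true = ⊥-elim (<-irrefl refl (<-≤-trans l (≤ᵇ⇒≤ (countPositive as) 2 (≡true⇒T eq))))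
... | false = refl

starValue-fuel : ∀ f f′ as → sum as < f → sum as < f′ → starValue f as ≡ starValue f′ as
starValue-fuel (suc F) (suc F′) as l l′ with countPositive as ≤ᵇ 2
... | true = refl
... | false = cong mex (map-cong-local (tabulate (λ {y} m →
      starValue-fuel F F′ y (<-≤-trans (sum-shortening< as y m) (≤-pred l)) (<-≤-trans (sum-shortening< as y m) (≤-pred l′)))))

path-mex : ∀ F as → countPositive as ≤ 2 → 2 ≤ sum as → mex (map (starValue (suc F)) (shortenings as)) ≡ mod3 (suc (sum as))
path-mex F as path 2≤sum = mex≡mod3 (suc (sum as)) (map (starValue (suc F)) (shortenings as)) options-of-path one-less two-less
  where
  value₁ : ∀ i → i < length as → 1 ≤ at as i → starValue (suc F) (modifyAt as i pred) ≡ mod3 (sum as)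
  value₁ i l p = trans (starValue-path F (modifyAt as i pred) (≤-trans (countPositive-modifyAt-≤ as i pred l pred[n]≤n) path))
                       (cong mod3 (sum-shorten₁ as i l p))
  value₂ : ∀ i → i < length as → 2 ≤ at as i → starValue (suc F) (modifyAt as i (pred ∘ pred)) ≡ mod3 (pred (sum as))
  value₂ i l p = trans (starValue-path F (modifyAt as i (pred ∘ pred)) (≤-trans (countPositive-modifyAt-≤ as i (pred ∘ pred) l (pred²≤ _)) path))
                       (cong (mod3 ∘ pred) (sum-shorten₂ as i l p))
  options-of-path : ∀ v → v ∈ map (starValue (suc F)) (shortenings as) →
    ∃ λ m′ → v ≡ mod3 m′ × (suc m′ ≡ suc (sum as) ⊎ suc (suc m′) ≡ suc (sum as))
  options-of-path v m with ∈-map⁻ (starValue (suc F)) m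
  ... | y , my , refl with shortenings⁻ as y my
  ... | i , l , inj₁ (p , refl) = sum as , value₁ i l p , inj₁ refl
  ... | i , l , inj₂ (p , refl) = pred (sum as) , value₂ i l p , inj₂ (cong suc (suc-pred (sum as) ⦃ >-nonZero (≤-trans (s≤s z≤n) 2≤sum) ⦄))
  one-less : ∀ m₁ → suc m₁ ≡ suc (sum as) → mod3 m₁ ∈ map (starValue (suc F)) (shortenings as)
  one-less m₁ refl with positive-arm as (≤-trans (s≤s z≤n) 2≤sum)
  ... | i , l , p = subst (_∈ _) (value₁ i l p) (∈-map⁺ (starValue (suc F)) (shorten₁∈shortenings as i l p))
  -- Without an arm of length ≥ 2 we have sum as = countPositive as = 2, and nothing lies below mod3 3 = 0.
  two-less : ∀ m₂ → suc (suc m₂) ≡ suc (sum as) → mod3 m₂ < mod3 (suc (sum as)) → mod3 m₂ ∈ map (starValue (suc F)) (shortenings as)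
  two-less m₂ e lt with countPositive as <? sum as
  ... | yes cp<sum with long-arm as cp<sum
  ...   | i , l , p = subst (_∈ _) (trans (value₂ i l p) (cong (mod3 ∘ pred) (sym (suc-injective e)))) (∈-map⁺ (starValue (suc F)) (shorten₂∈shortenings as i l p))
  two-less m₂ e lt | no cp≮sum = ⊥-elim (no-value-below-0 m₂ (≤-antisym (≤-trans (≮⇒≥ cp≮sum) path) 2≤sum) e lt)
    where
    no-value-below-0 : ∀ m₂ → sum as ≡ 2 → suc (suc m₂) ≡ suc (sum as) → mod3 m₂ < mod3 (suc (sum as)) → ⊥
    no-value-below-0 m₂ s≡2 e lt rewrite s≡2 with e
    ... | refl with lt
    ... | ()

starValue-mex : ∀ F x → 2 ≤ sum x → starValue (suc (suc F)) x ≡ mex (map (starValue (suc F)) (shortenings x))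
starValue-mex F x 2≤sum with countPositive x ≤? 2
... | yes path = trans (starValue-path (suc F) x path) (sym (path-mex F x path 2≤sum))
... | no branching = starValue-branching (suc F) x (≰⇒> branching)

starValue≢shortening : ∀ f g x y → y ∈ shortenings x → 2 ≤ sum x → sum x < f → sum y < g → starValue f x ≢ starValue g y
starValue≢shortening (suc (suc (suc f))) g x y m 2≤sum lf lg e =
  ∈⇒≢mex (map (starValue (suc (suc f))) (shortenings x)) _ (∈-map⁺ (starValue (suc (suc f))) m)
    (trans (starValue-fuel (suc (suc f)) g y (<-≤-trans (sum-shortening< x y m) (≤-pred lf)) lg) (trans (sym e) (starValue-mex (suc f) x 2≤sum)))
starValue≢shortening (suc zero) g x y m 2≤sum (s≤s lf) lg e = ≤⇒≯ lf (≤-trans (s≤s z≤n) 2≤sum)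
starValue≢shortening (suc (suc zero)) g x y m 2≤sum (s≤s lf) lg e = ≤⇒≯ lf 2≤sum

pred-∸3 : ∀ a → pred a ∸ 3 ≡ pred (a ∸ 3)
pred-∸3 zero = refl
pred-∸3 (suc zero) = refl
pred-∸3 (suc (suc zero)) = refl
pred-∸3 (suc (suc (suc zero))) = refl
pred-∸3 (suc (suc (suc (suc a)))) = refl

pred²-∸3 : ∀ a → pred (pred a) ∸ 3 ≡ pred (pred (a ∸ 3))
pred²-∸3 a = trans (pred-∸3 (pred a)) (cong pred (pred-∸3 a))

StarValue-∸3 : ℕ → Set
StarValue-∸3 f = ∀ as i → sum as < f → i < length as → 3 ≤ at as i → starValue f as ≡ starValue f (modifyAt as i (_∸ 3))

-- Every option of as′ lifts to an option of as through the induction hypothesis.  An option of as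
-- either lifts back the same way or shortens arm i, and then it has as′ itself as an option, so its
-- value differs from mex B = starValue as′.
module ∸3-Step (F : ℕ) (ih : StarValue-∸3 (suc F)) (as : List ℕ) (i : ℕ)
  (lf : sum as < suc (suc F)) (li : i < length as) (l3 : 3 ≤ at as i) (branching : 3 ≤ countPositive as) where

  as′ : List ℕ
  as′ = modifyAt as i (_∸ 3)

  A B : List ℕ
  A = map (starValue (suc F)) (shortenings as)
  B = map (starValue (suc F)) (shortenings as′)

  li′ : i < length as′
  li′ = <length-modifyAt as i (_∸ 3) li

  at-as′-same : at as′ i ≡ at as i ∸ 3
  at-as′-same = at-modifyAt-same as i (_∸ 3) li

  at-as′-other : ∀ j → j ≢ i → at as′ j ≡ at as j
  at-as′-other j ne = at-modifyAt-other as i j (_∸ 3) (ne ∘ sym)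

  2≤countPositive-as′ : 2 ≤ countPositive as′
  2≤countPositive-as′ = +-cancelʳ-≤ 1 2 (countPositive as′) (begin
    3                                            ≤⟨ branching ⟩
    countPositive as                             ≤⟨ m≤n+m _ (signum (at as i ∸ 3)) ⟩
    signum (at as i ∸ 3) + countPositive as      ≡⟨ sym (countPositive-modifyAt as i (_∸ 3) li) ⟩
    countPositive as′ + signum (at as i)         ≤⟨ +-monoʳ-≤ (countPositive as′) (signum≤1 (at as i)) ⟩
    countPositive as′ + 1                        ∎)
    where
    open ≤-Reasoning
    signum≤1 : ∀ a → signum a ≤ 1
    signum≤1 zero = z≤n
    signum≤1 (suc a) = ≤-refl

  2≤sum-as′ : 2 ≤ sum as′
  2≤sum-as′ = ≤-trans 2≤countPositive-as′ (countPositive≤sum as′)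

  sum-as′< : sum as′ < suc F
  sum-as′< = ≤-trans (m≤n+m (suc (sum as′)) 2) (≤-trans (≤-reflexive (sum-shorten₃ as i li l3)) (≤-pred lf))

  sum<F : ∀ x → x ∈ shortenings as → sum x < suc F
  sum<F x m = <-≤-trans (sum-shortening< as x m) (≤-pred lf)

  shortened-elsewhere : ∀ j g → modifyAt as j g ∈ shortenings as → j ≢ i →
    starValue (suc F) (modifyAt as j g) ≡ starValue (suc F) (modifyAt as′ j g)
  shortened-elsewhere j g m ne =
    trans (ih (modifyAt as j g) i (sum<F _ m) (<length-modifyAt as j g li) (subst (3 ≤_) (sym (at-modifyAt-other as j i g ne)) l3))
          (cong (starValue (suc F)) (modifyAt-comm as j i g (_∸ 3) ne))

  shortened-here : ∀ g → modifyAt as i g ∈ shortenings as → 3 ≤ g (at as i) → g (at as i) ∸ 3 ≡ g (at as i ∸ 3) →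
    starValue (suc F) (modifyAt as i g) ≡ starValue (suc F) (modifyAt as′ i g)
  shortened-here g m p c =
    trans (ih (modifyAt as i g) i (sum<F _ m) (<length-modifyAt as i g li) (subst (3 ≤_) (sym (at-modifyAt-same as i g li)) p))
          (cong (starValue (suc F)) (trans (modifyAt-∘ as i g (_∸ 3)) (trans (modifyAt-cong as i _ _ c) (sym (modifyAt-∘ as i (_∸ 3) g)))))

  3+≤ : ∀ k → k ≤ at as′ i → 3 + k ≤ at as i
  3+≤ k p = ≤-trans (+-monoʳ-≤ 3 (subst (k ≤_) at-as′-same p)) (≤-reflexive (m+[n∸m]≡n l3))

  B⊆A : ∀ v → v ∈ B → v ∈ A
  B⊆A v mv with ∈-map⁻ (starValue (suc F)) mv
  ... | y , my , refl with shortenings⁻ as′ y my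
  ... | j , lj , inj₁ (p , refl) with j ≟ i
  ...   | no ne = subst (_∈ A) (shortened-elsewhere j pred m ne) (∈-map⁺ (starValue (suc F)) m)
    where
    m : modifyAt as j pred ∈ shortenings as
    m = shorten₁∈shortenings as j (subst (j <_) (length-modifyAt as i (_∸ 3)) lj) (subst (1 ≤_) (at-as′-other j ne) p)
  ...   | yes refl = subst (_∈ A) (shortened-here pred m (pred-mono-≤ (3+≤ 1 p)) (pred-∸3 (at as i))) (∈-map⁺ (starValue (suc F)) m)
    where
    m : modifyAt as i pred ∈ shortenings as
    m = shorten₁∈shortenings as i li (≤-trans (s≤s z≤n) (3+≤ 1 p))
  B⊆A v mv | y , my , refl | j , lj , inj₂ (p , refl) with j ≟ i
  ...   | no ne = subst (_∈ A) (shortened-elsewhere j (pred ∘ pred) m ne) (∈-map⁺ (starValue (suc F)) m)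
    where
    m : modifyAt as j (pred ∘ pred) ∈ shortenings as
    m = shorten₂∈shortenings as j (subst (j <_) (length-modifyAt as i (_∸ 3)) lj) (subst (2 ≤_) (at-as′-other j ne) p)
  ...   | yes refl = subst (_∈ A) (shortened-here (pred ∘ pred) m (pred-mono-≤ (pred-mono-≤ (3+≤ 2 p))) (pred²-∸3 (at as i))) (∈-map⁺ (starValue (suc F)) m)
    where
    m : modifyAt as i (pred ∘ pred) ∈ shortenings as
    m = shorten₂∈shortenings as i li (≤-trans (s≤s (s≤s z≤n)) (3+≤ 2 p))

  mexB≡ : mex B ≡ starValue (suc (suc F)) as′
  mexB≡ = sym (starValue-mex F as′ 2≤sum-as′)

  ≢mexB-via-as′ : ∀ x → x ∈ shortenings as → as′ ∈ shortenings x → starValue (suc F) x ≢ mex B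
  ≢mexB-via-as′ x m m′ e = starValue≢shortening (suc F) (suc (suc F)) x as′ m′
    (≤-trans 2≤sum-as′ (<⇒≤ (sum-shortening< x as′ m′))) (sum<F x m) (m<n⇒m<1+n sum-as′<) (trans e mexB≡)

  pred³≡∸3 : pred (pred (pred (at as i))) ≡ at as i ∸ 3
  pred³≡∸3 = lemma (at as i) l3
    where
    lemma : ∀ a → 3 ≤ a → pred (pred (pred a)) ≡ a ∸ 3
    lemma (suc (suc (suc a))) _ = refl
    lemma (suc zero) (s≤s ())
    lemma (suc (suc zero)) (s≤s (s≤s ()))

  as′∈shortenings₁ : as′ ∈ shortenings (modifyAt as i pred)
  as′∈shortenings₁ =
    subst (_∈ shortenings (modifyAt as i pred)) (trans (modifyAt-∘ as i pred (pred ∘ pred)) (modifyAt-cong as i _ _ pred³≡∸3))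
      (shorten₂∈shortenings (modifyAt as i pred) i (<length-modifyAt as i pred li)
        (subst (2 ≤_) (sym (at-modifyAt-same as i pred li)) (pred-mono-≤ l3)))

  as′∈shortenings₂ : as′ ∈ shortenings (modifyAt as i (pred ∘ pred))
  as′∈shortenings₂ =
    subst (_∈ shortenings (modifyAt as i (pred ∘ pred))) (trans (modifyAt-∘ as i (pred ∘ pred) pred) (modifyAt-cong as i _ _ pred³≡∸3))
      (shorten₁∈shortenings (modifyAt as i (pred ∘ pred)) i (<length-modifyAt as i (pred ∘ pred) li)
        (subst (1 ≤_) (sym (at-modifyAt-same as i (pred ∘ pred) li)) (pred-mono-≤ (pred-mono-≤ l3))))

  A∌mexB : ∀ v → v ∈ A → v ≢ mex B
  A∌mexB v mv with ∈-map⁻ (starValue (suc F)) mv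
  ... | x , mx , refl with shortenings⁻ as x mx
  ... | j , lj , inj₁ (p , refl) with j ≟ i
  ...   | yes refl = ≢mexB-via-as′ _ mx as′∈shortenings₁
  ...   | no ne = λ e → ∈⇒≢mex B _ (∈-map⁺ (starValue (suc F)) m) (trans (sym (shortened-elsewhere j pred mx ne)) e)
    where
    m : modifyAt as′ j pred ∈ shortenings as′
    m = shorten₁∈shortenings as′ j (<length-modifyAt as i (_∸ 3) lj) (subst (1 ≤_) (sym (at-as′-other j ne)) p)
  A∌mexB v mv | x , mx , refl | j , lj , inj₂ (p , refl) with j ≟ i
  ...   | yes refl = ≢mexB-via-as′ _ mx as′∈shortenings₂
  ...   | no ne = λ e → ∈⇒≢mex B _ (∈-map⁺ (starValue (suc F)) m) (trans (sym (shortened-elsewhere j (pred ∘ pred) mx ne)) e)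
    where
    m : modifyAt as′ j (pred ∘ pred) ∈ shortenings as′
    m = shorten₂∈shortenings as′ j (<length-modifyAt as i (_∸ 3) lj) (subst (2 ≤_) (sym (at-as′-other j ne)) p)

  starValue-as≡as′ : starValue (suc (suc F)) as ≡ starValue (suc (suc F)) as′
  starValue-as≡as′ = trans (starValue-branching (suc F) as branching)
    (trans (mex-unique A (mex B) A∌mexB (λ j j<mexB → B⊆A j (<mex⇒∈ B j j<mexB))) mexB≡)

starValue-∸3 : ∀ f → StarValue-∸3 f
starValue-∸3 (suc F) as i lf li l3 with countPositive as ≤? 2
... | yes path = begin
  starValue (suc F) as              ≡⟨ starValue-path F as path ⟩
  mod3 (suc (sum as))               ≡⟨ cong (mod3 ∘ suc) (sym (sum-shorten₃ as i li l3)) ⟩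
  mod3 (suc (sum as′))              ≡⟨ sym (starValue-path F as′ (≤-trans (countPositive-modifyAt-≤ as i (_∸ 3) li (m∸n≤m _ 3)) path)) ⟩
  starValue (suc F) as′             ∎
  where
  open ≡-Reasoning
  as′ : List ℕ
  as′ = modifyAt as i (_∸ 3)
... | no branching with F
...   | suc F′ = ∸3-Step.starValue-as≡as′ F′ (starValue-∸3 (suc F′)) as i lf li l3 (≰⇒> branching)
...   | zero = ⊥-elim (≤⇒≯ (≤-pred lf) (≤-trans (s≤s z≤n) (≤-trans (≰⇒> branching) (countPositive≤sum as))))

starValue-mod3-arm : ∀ k f as i → at as i ≤ k → sum as < f → i < length as → starValue f as ≡ starValue f (modifyAt as i mod3)
starValue-mod3-arm k f as i lk lf li with 3 ≤? at as i
... | no short = cong (starValue f) (sym (modifyAt-id as i mod3 (mod3-small (at as i) (≰⇒> short))))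
starValue-mod3-arm zero f as i lk lf li | yes l3 = ⊥-elim (≤⇒≯ lk (≤-trans (s≤s z≤n) l3))
starValue-mod3-arm (suc k) f as i lk lf li | yes l3 = begin
  starValue f as                          ≡⟨ starValue-∸3 f as i lf li l3 ⟩
  starValue f as′                         ≡⟨ starValue-mod3-arm k f as′ i lk′ (≤-<-trans (sum-modifyAt-≤ as i (_∸ 3) (λ x → m∸n≤m x 3)) lf)
                                               (<length-modifyAt as i (_∸ 3) li) ⟩
  starValue f (modifyAt as′ i mod3)       ≡⟨ cong (starValue f) (trans (modifyAt-∘ as i (_∸ 3) mod3) (modifyAt-cong as i _ _ (mod3-∸3 (at as i) l3))) ⟩
  starValue f (modifyAt as i mod3)        ∎
  where
  open ≡-Reasoning
  as′ : List ℕ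
  as′ = modifyAt as i (_∸ 3)
  lk′ : at as′ i ≤ k
  lk′ = subst (_≤ k) (sym (at-modifyAt-same as i (_∸ 3) li)) (≤-trans (∸-monoˡ-≤ 3 lk) (m∸n≤m k 2))

starValue-mod3-suffix : ∀ f ls pre → sum (pre ++ ls) < f → starValue f (pre ++ ls) ≡ starValue f (pre ++ map mod3 ls)
starValue-mod3-suffix f [] pre lf = refl
starValue-mod3-suffix f (l ∷ ls) pre lf = begin
  starValue f (pre ++ l ∷ ls)                          ≡⟨ starValue-mod3-arm l f (pre ++ l ∷ ls) (length pre) (≤-reflexive (at-++-length pre l ls)) lf
                                                            (length<length-++∷ pre l ls) ⟩
  starValue f (modifyAt (pre ++ l ∷ ls) (length pre) mod3) ≡⟨ cong (starValue f) reassociate ⟩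
  starValue f ((pre ++ mod3 l ∷ []) ++ ls)             ≡⟨ starValue-mod3-suffix f ls (pre ++ mod3 l ∷ []) lf′ ⟩
  starValue f ((pre ++ mod3 l ∷ []) ++ map mod3 ls)    ≡⟨ cong (starValue f) (++-assoc pre (mod3 l ∷ []) (map mod3 ls)) ⟩
  starValue f (pre ++ mod3 l ∷ map mod3 ls)            ∎
  where
  open ≡-Reasoning
  reassociate : modifyAt (pre ++ l ∷ ls) (length pre) mod3 ≡ (pre ++ mod3 l ∷ []) ++ ls
  reassociate = trans (modifyAt-++-length pre l ls mod3) (sym (++-assoc pre (mod3 l ∷ []) ls))
  lf′ : sum ((pre ++ mod3 l ∷ []) ++ ls) < f
  lf′ = subst (λ z → sum z < f) reassociate (≤-<-trans (sum-modifyAt-≤ (pre ++ l ∷ ls) (length pre) mod3 mod3≤) lf)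

starValue-mod3 : ∀ f ls → sum ls < f → starValue f ls ≡ starValue f (map mod3 ls)
starValue-mod3 f ls = starValue-mod3-suffix f ls []

starValue-path′ : ∀ f as → countPositive as ≤ 2 → sum as < f → starValue f as ≡ mod3 (suc (sum as))
starValue-path′ (suc f) as path _ = starValue-path f as path

-- Positions reachable from the star

without-true⁻ : ∀ X (α : ℕ → Bool) w → without X α w ≡ true → α w ≡ true × (w ∈ᵇ X) ≡ false
without-true⁻ X α w e with ∧-true⁻ (α w) _ e
... | a , b = a , not-true⁻ b

without-true⁺ : ∀ X (α : ℕ → Bool) w → α w ≡ true → (w ∈ᵇ X) ≡ false → without X α w ≡ true
without-true⁺ X α w a b rewrite a | b = refl

without-false : ∀ X (α : ℕ → Bool) w → α w ≡ false → without X α w ≡ false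
without-false X α w a rewrite a = refl

without-deleted : ∀ X (α : ℕ → Bool) w → (w ∈ᵇ X) ≡ true → without X α w ≡ false
without-deleted X α w a rewrite a with α w
... | true = refl
... | false = refl

∉single : ∀ w v → w ≢ v → (w ∈ᵇ (v ∷ [])) ≡ false
∉single w v ne rewrite ≢⇒≡ᵇ-false w v ne = refl

∉single⁻ : ∀ w v → (w ∈ᵇ (v ∷ [])) ≡ false → w ≢ v
∉single⁻ w v e refl rewrite ≡ᵇ-refl w = true≢false e

∈single : ∀ v → (v ∈ᵇ (v ∷ [])) ≡ true
∈single v rewrite ≡ᵇ-refl v = refl

IsPair : ℕ → ℕ → ℕ → ℕ → Set
IsPair u v a b = (u ≡ a × v ≡ b) ⊎ (u ≡ b × v ≡ a)

IsPair⇒∈ : ∀ {u v a b} → IsPair u v a b → a ∈ (u ∷ v ∷ []) × b ∈ (u ∷ v ∷ [])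
IsPair⇒∈ (inj₁ (refl , refl)) = here refl , there (here refl)
IsPair⇒∈ (inj₂ (refl , refl)) = there (here refl) , here refl

∉pair : ∀ w u v a b → IsPair u v a b → w ≢ a → w ≢ b → (w ∈ᵇ (u ∷ v ∷ [])) ≡ false
∉pair w u v a b (inj₁ (refl , refl)) na nb rewrite ≢⇒≡ᵇ-false w u na | ≢⇒≡ᵇ-false w v nb = refl
∉pair w u v a b (inj₂ (refl , refl)) na nb rewrite ≢⇒≡ᵇ-false w u nb | ≢⇒≡ᵇ-false w v na = refl

∉pair⁻ : ∀ w u v a b → IsPair u v a b → (w ∈ᵇ (u ∷ v ∷ [])) ≡ false → w ≢ a × w ≢ b
∉pair⁻ w u v a b p e =
  (λ { refl → true≢false (trans (sym (∈⇒∈ᵇ w _ (proj₁ (IsPair⇒∈ p)))) e) }) ,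
  (λ { refl → true≢false (trans (sym (∈⇒∈ᵇ w _ (proj₂ (IsPair⇒∈ p)))) e) })

∈pair₁ : ∀ u v a b → IsPair u v a b → (a ∈ᵇ (u ∷ v ∷ [])) ≡ true
∈pair₁ u v a b p = ∈⇒∈ᵇ a _ (proj₁ (IsPair⇒∈ p))

∈pair₂ : ∀ u v a b → IsPair u v a b → (b ∈ᵇ (u ∷ v ∷ [])) ≡ true
∈pair₂ u v a b p = ∈⇒∈ᵇ b _ (proj₂ (IsPair⇒∈ p))

IsPair-≤ : ∀ {u v a b c} → IsPair u v a b → a ≤ c → b ≤ c → u ≤ c
IsPair-≤ (inj₁ (refl , _)) a≤c _ = a≤c
IsPair-≤ (inj₂ (refl , _)) _ b≤c = b≤c

_⟺_ : Set → Set → Set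
A ⟺ B = (A → B) × (B → A)

module Positions (ls : List ℕ) where
  open Star ls

  -- The star with arm i cut down to its first at as i vertices.
  Truncated : (ℕ → Bool) → List ℕ → Set
  Truncated α as = α 0 ≡ true × length as ≡ K × (∀ i → at as i ≤ len i) ×
     (∀ w → 1 ≤ w → w ≤ N → (α w ≡ true) ⟺ (w < start (arm w) + at as (arm w)))

  -- Centre deleted, only the m consecutive vertices x, …, x + m - 1 of one arm remain.
  Segment : (ℕ → Bool) → ℕ → ℕ → Set
  Segment α x m = α 0 ≡ false × (∀ w → 1 ≤ w → w ≤ N → (α w ≡ true) ⟺ (x ≤ w × w < x + m)) ×
     (1 ≤ m → 1 ≤ x × x ≤ N × x + m ≤ start (arm x) + len (arm x))

  in-arm : ∀ i u → i < K → start i ≤ u → u < start i + len i → 1 ≤ u × u ≤ N × arm u ≡ i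
  in-arm i u li l1 l2 = ≤-trans (start≥1 i) l1 , ≤-pred (<-≤-trans l2 (armEnd≤ i li)) , arm-unique i u li l1 l2

  Truncated⇒Connected : ∀ α as → Truncated α as → Connected α
  Truncated⇒Connected α as (a0 , lenE , ale , alive⇔) = walks⇒Connected α 0 from-hub
    where
    from-hub : ∀ w → w ≤ N → α w ≡ true → Walk (pos α) 0 w
    from-hub zero _ _ = []
    from-hub w@(suc _) wN aw with arm-spec w (s≤s z≤n) wN
    ... | li , l1 , l2 = subst (Walk (pos α) 0) (m+[n∸m]≡n l1)
          (hub-walk α i B li (+-monoʳ-≤ (start i) (ale i)) a0 alive-arm (w ∸ start i)
             (subst (_< B) (sym (m+[n∸m]≡n l1)) (proj₁ (alive⇔ w (s≤s z≤n) wN) aw)))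
      where
      i B : ℕ
      i = arm w
      B = start i + at as i
      alive-arm : ∀ u → start i ≤ u → u < B → α u ≡ true
      alive-arm u l1′ l2′ with in-arm i u li l1′ (<-≤-trans l2′ (+-monoʳ-≤ (start i) (ale i)))
      ... | u1 , uN , ui = proj₂ (alive⇔ u u1 uN) (subst (λ z → u < start z + at as z) (sym ui) l2′)

  Segment-hub : ∀ {α x m} → Segment α x m → ∀ w → w ≤ N → α w ≡ true → 1 ≤ w
  Segment-hub (a0 , _) zero _ aw = ⊥-elim (true≢false (trans (sym aw) a0))
  Segment-hub _ (suc w) _ _ = s≤s z≤n

  Segment⇒Connected : ∀ α x m → Segment α x m → Connected α
  Segment⇒Connected α x zero seg@(a0 , alive⇔ , _) v w vN _ av _ =
    ⊥-elim (≤⇒≯ (proj₁ xv) (subst (v <_) (+-identityʳ x) (proj₂ xv)))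
    where
    xv : x ≤ v × v < x + 0
    xv = proj₁ (alive⇔ v (Segment-hub seg v vN av) vN) av
  Segment⇒Connected α x (suc m) seg@(a0 , alive⇔ , range) with range (s≤s z≤n)
  ... | x1 , xN , xe = walks⇒Connected α x from-x
    where
    lx : arm x < K
    lx = proj₁ (arm-spec x x1 xN)
    from-x : ∀ w → w ≤ N → α w ≡ true → Walk (pos α) x w
    from-x w wN aw with proj₁ (alive⇔ w (Segment-hub seg w wN aw) wN) aw
    ... | l1 , l2 = subst (Walk (pos α) x) (m+[n∸m]≡n l1)
        (segment-walk α (arm x) x (x + suc m) lx (start-arm≤ x x1 xN) xe alive-segment (w ∸ x)
          (subst (_< x + suc m) (sym (m+[n∸m]≡n l1)) l2))
      where
      alive-segment : ∀ u → x ≤ u → u < x + suc m → α u ≡ true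
      alive-segment u l1′ l2′ = proj₂ (alive⇔ u (≤-trans x1 l1′) (≤-pred (<-≤-trans l2′ (≤-trans xe (armEnd≤ (arm x) lx))))) (l1′ , l2′)

  Connected⇒legal : ∀ α x X → Connected (without (x ∷ X) α) → legal (pos α) (x ∷ X) ≡ true
  Connected⇒legal α x X c = legal⁺ (pos α) x X (λ w w′ l l′ a a′ → c w w′ (≤-pred l) (≤-pred l′) a a′)

  Segment-restrict : ∀ α X x m x′ m′ → Segment α x m →
    (∀ w → 1 ≤ w → w ≤ N → x ≤ w → w < x + m → (w ∈ᵇ X) ≡ false → x′ ≤ w × w < x′ + m′) →
    (∀ w → x′ ≤ w → w < x′ + m′ → x ≤ w × w < x + m × (w ∈ᵇ X) ≡ false) →
    (1 ≤ m′ → 1 ≤ m) → x ≤ x′ → x′ + m′ ≤ x + m → Segment (without X α) x′ m′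
  Segment-restrict α X x m x′ m′ (a0 , alive⇔ , range) kept within nonempty lx lxm = without-false X α 0 a0 , alive⇔′ , range′
    where
    alive⇔′ : ∀ w → 1 ≤ w → w ≤ N → (without X α w ≡ true) ⟺ (x′ ≤ w × w < x′ + m′)
    alive⇔′ w w1 wN =
      (λ e → let (aw , w∉X) = without-true⁻ X α w e ; (p1 , p2) = proj₁ (alive⇔ w w1 wN) aw in kept w w1 wN p1 p2 w∉X) ,
      (λ { (p1 , p2) → let (q1 , q2 , w∉X) = within w p1 p2 in without-true⁺ X α w (proj₂ (alive⇔ w w1 wN) (q1 , q2)) w∉X })
    range′ : 1 ≤ m′ → 1 ≤ x′ × x′ ≤ N × x′ + m′ ≤ start (arm x′) + len (arm x′)
    range′ l with range (nonempty l)
    ... | x1 , xN , xe with arm-spec x x1 xN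
    ... | li , lo , _ with in-arm (arm x) x′ li (≤-trans lo lx) (<-≤-trans (<-≤-trans (m<m+n x′ l) lxm) xe)
    ... | a , b , c = a , b , subst (λ z → x′ + m′ ≤ start z + len z) (sym c) (≤-trans lxm xe)

  Segment-dropFirst₁ : ∀ α x m → Segment α x (suc m) → Segment (without (x ∷ []) α) (suc x) m
  Segment-dropFirst₁ α x m seg = Segment-restrict α (x ∷ []) x (suc m) (suc x) m seg
    (λ w _ _ p1 p2 w∉X → ≤∧≢⇒< p1 (∉single⁻ w x w∉X ∘ sym) , subst (w <_) (+-suc x m) p2)
    (λ w p1 p2 → ≤-trans (n≤1+n x) p1 , subst (w <_) (sym (+-suc x m)) p2 , ∉single w x (λ e → <-irrefl (sym e) p1))
    (λ _ → s≤s z≤n) (n≤1+n x) (≤-reflexive (sym (+-suc x m)))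

  Segment-dropFirst₂ : ∀ α x m u v → IsPair u v x (suc x) → Segment α x (suc (suc m)) →
    Segment (without (u ∷ v ∷ []) α) (suc (suc x)) m
  Segment-dropFirst₂ α x m u v pair seg = Segment-restrict α (u ∷ v ∷ []) x (suc (suc m)) (suc (suc x)) m seg
    (λ w _ _ p1 p2 w∉X → let (w≢x , w≢sx) = ∉pair⁻ w u v x (suc x) pair w∉X in
       ≤∧≢⇒< (≤∧≢⇒< p1 (w≢x ∘ sym)) (w≢sx ∘ sym) , subst (w <_) shift p2)
    (λ w p1 p2 → ≤-trans (m≤n+m x 2) p1 , subst (w <_) (sym shift) p2 ,
       ∉pair w u v x (suc x) pair (λ e → <-irrefl (sym e) (<-trans (n<1+n x) p1)) (λ e → <-irrefl (sym e) p1))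
    (λ _ → s≤s z≤n) (m≤n+m x 2) (≤-reflexive (sym shift))
    where
    shift : x + suc (suc m) ≡ suc (suc x) + m
    shift = trans (+-suc x (suc m)) (cong suc (+-suc x m))

  Segment-dropLast₁ : ∀ α x m → Segment α x (suc m) → Segment (without (x + m ∷ []) α) x m
  Segment-dropLast₁ α x m seg = Segment-restrict α (x + m ∷ []) x (suc m) x m seg
    (λ w _ _ p1 p2 w∉X → p1 , ≤∧≢⇒< (≤-pred (subst (w <_) (+-suc x m) p2)) (∉single⁻ w (x + m) w∉X))
    (λ w p1 p2 → p1 , <-trans p2 (+-monoʳ-< x (n<1+n m)) , ∉single w (x + m) (λ e → <-irrefl e p2))
    (λ _ → s≤s z≤n) ≤-refl (+-monoʳ-≤ x (n≤1+n m))

  Segment-dropLast₂ : ∀ α x m u v → IsPair u v (x + m) (suc (x + m)) → Segment α x (suc (suc m)) →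
    Segment (without (u ∷ v ∷ []) α) x m
  Segment-dropLast₂ α x m u v pair seg = Segment-restrict α (u ∷ v ∷ []) x (suc (suc m)) x m seg
    (λ w _ _ p1 p2 w∉X → let (n₁ , n₂) = ∉pair⁻ w u v (x + m) (suc (x + m)) pair w∉X in
       p1 , ≤∧≢⇒< (≤-pred (≤∧≢⇒< (≤-pred (subst (w <_) shift p2)) n₂)) n₁)
    (λ w p1 p2 → p1 , <-trans p2 (+-monoʳ-< x (<-trans (n<1+n m) (n<1+n (suc m)))) ,
       ∉pair w u v (x + m) (suc (x + m)) pair (λ e → <-irrefl e p2) (λ e → <-irrefl e (<-trans p2 (n<1+n (x + m)))))
    (λ _ → s≤s z≤n) ≤-refl (+-monoʳ-≤ x (m≤n+m m 2))
    where
    shift : x + suc (suc m) ≡ suc (suc (x + m))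
    shift = trans (+-suc x (suc m)) (cong suc (+-suc x m))

  Segment-interior-illegal : ∀ α x m → Segment α x m → ∀ y Y t → y ≤ N → α y ≡ true →
    x < t → t < x + m → (pred t ∈ᵇ (y ∷ Y)) ≡ true → (t ∈ᵇ (y ∷ Y)) ≡ false → (x ∈ᵇ (y ∷ Y)) ≡ false →
    legal (pos α) (y ∷ Y) ≡ true → ⊥
  Segment-interior-illegal α x zero _ y Y t yN ay x<t t<x _ _ _ _ = <-asym x<t (subst (t <_) (+-identityʳ x) t<x)
  Segment-interior-illegal α x m@(suc _) seg@(a0 , alive⇔ , range) y Y t yN ay x<t t<xm t′∈X t∉X x∉X lg
    with range (s≤s z≤n)
  ... | x1 , xN , xe with arm-spec x x1 xN
  ...   | li , lo , _ with in-arm (arm x) t li (≤-trans lo (<⇒≤ x<t)) (<-≤-trans t<xm xe)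
  ...     | t1 , tN , ti =
    cut⇒illegal α (Segment⇒Connected α x m seg) y Y (arm x) t x cut yN ay αt t∉X xN αx x∉X x∉tail lg
    where
    αt : α t ≡ true
    αt = proj₂ (alive⇔ t t1 tN) (<⇒≤ x<t , t<xm)
    αx : α x ≡ true
    αx = proj₂ (alive⇔ x x1 xN) (≤-refl , m<m+n x (s≤s z≤n))
    cut : TailCut (without (y ∷ Y) α) (arm x) t
    cut = ti , t1 , tN , (λ _ → without-false (y ∷ Y) α 0 a0) , (λ _ → without-deleted (y ∷ Y) α (pred t) t′∈X)
    x∉tail : tailSet (arm x) t x ≡ false
    x∉tail = tailSet-false⁺ (arm x) t x (λ c → <⇒≱ x<t (proj₂ (proj₂ (proj₂ (tailSet-true⁻ (arm x) t x c)))))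

  ShorterSegment : (ℕ → Bool) → ℕ → Set
  ShorterSegment β m = ∃ λ x′ → ∃ λ m′ → Segment β x′ m′ × (suc m′ ≡ m ⊎ suc (suc m′) ≡ m)

  Segment-alive⁻ : ∀ {α x m} → Segment α x m → ∀ w → w ≤ N → α w ≡ true → x ≤ w × w < x + m
  Segment-alive⁻ seg@(_ , alive⇔ , _) w wN aw = proj₁ (alive⇔ w (Segment-hub seg w wN aw) wN) aw

  segment-single-move : ∀ α x m → Segment α x m → ∀ v → v ≤ N → α v ≡ true → legal (pos α) (v ∷ []) ≡ true →
    ShorterSegment (without (v ∷ []) α) m
  segment-single-move α x m seg v vN av lg with Segment-alive⁻ seg v vN av
  segment-single-move α x zero seg v vN av lg | x≤v , v<x = ⊥-elim (≤⇒≯ x≤v (subst (v <_) (+-identityʳ x) v<x))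
  segment-single-move α x (suc m) seg v vN av lg | x≤v , v<x+1+m with v ≟ x
  ... | yes refl = suc x , m , Segment-dropFirst₁ α x m seg , inj₁ refl
  ... | no v≢x with v ≟ x + m
  ...   | yes refl = x , m , Segment-dropLast₁ α x m seg , inj₁ refl
  ...   | no v≢last = ⊥-elim (Segment-interior-illegal α x (suc m) seg v [] (suc v) vN av (s≤s x≤v)
            (subst (suc v <_) (sym (+-suc x m)) (s≤s (≤∧≢⇒< (≤-pred (subst (v <_) (+-suc x m) v<x+1+m)) v≢last)))
            (∈single v) (∉single (suc v) v (λ e → <-irrefl (sym e) (n<1+n v))) (∉single x v (v≢x ∘ sym)) lg)

  segment-pair-move : ∀ α x m → Segment α x m → ∀ u v lo → IsPair u v lo (suc lo) → suc lo ≤ N →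
    α u ≡ true → α lo ≡ true → α (suc lo) ≡ true → legal (pos α) (u ∷ v ∷ []) ≡ true → ShorterSegment (without (u ∷ v ∷ []) α) m
  segment-pair-move α x m seg u v lo pair sloN au alo aslo lg
    with Segment-alive⁻ seg lo (≤-trans (n≤1+n lo) sloN) alo | Segment-alive⁻ seg (suc lo) sloN aslo
  ... | x≤lo , _ | _ , slo<x+m = go m slo<x+m seg
    where
    uN : u ≤ N
    uN = IsPair-≤ pair (≤-trans (n≤1+n lo) sloN) sloN
    go : ∀ m → suc lo < x + m → Segment α x m → ShorterSegment (without (u ∷ v ∷ []) α) m
    go zero slo<x _ = ⊥-elim (≤⇒≯ (≤-trans x≤lo (n≤1+n lo)) (subst (suc lo <_) (+-identityʳ x) slo<x))
    go (suc zero) slo<x+1 _ = ⊥-elim (≤⇒≯ x≤lo (≤-pred (subst (suc lo <_) (+-comm x 1) slo<x+1)))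
    go (suc (suc m)) slo<x+2+m seg with lo ≟ x
    ... | yes refl = suc (suc x) , m , Segment-dropFirst₂ α x m u v pair seg , inj₂ refl
    ... | no lo≢x with lo ≟ x + m
    ...   | yes refl = x , m , Segment-dropLast₂ α x m u v pair seg , inj₂ refl
    ...   | no lo≢last = ⊥-elim (Segment-interior-illegal α x (suc (suc m)) seg u (v ∷ []) (suc (suc lo)) uN au
              (s≤s (≤-trans x≤lo (n≤1+n lo))) (subst (suc (suc lo) <_) (sym shift) (s≤s (s≤s lo<x+m)))
              (∈pair₂ u v lo (suc lo) pair)
              (∉pair (suc (suc lo)) u v lo (suc lo) pair (λ e → <-irrefl (sym e) (<-trans (n<1+n lo) (n<1+n (suc lo))))
                 (λ e → <-irrefl (sym e) (n<1+n (suc lo))))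
              (∉pair x u v lo (suc lo) pair (lo≢x ∘ sym) (λ e → <-irrefl e (s≤s x≤lo)))
              lg)
      where
      shift : x + suc (suc m) ≡ suc (suc (x + m))
      shift = trans (+-suc x (suc m)) (cong suc (+-suc x m))
      lo<x+m : lo < x + m
      lo<x+m = ≤∧≢⇒< (≤-pred (≤-pred (subst (suc lo <_) shift slo<x+2+m))) lo≢last

  segment-move : ∀ α x m → Segment α x m → ∀ X → Move (pos α) X → ShorterSegment (without X α) m
  segment-move α x m seg@(a0 , _) X (mX , lg) with candidates⁻ (pos α) X mX
  ... | inj₁ (v , refl , vl , av) = segment-single-move α x m seg v (≤-pred vl) av lg
  ... | inj₂ (u , v , refl , lu , lv , e) with E⇒Adjacent α u v e | E-true⁻ (pos α) u v e
  ...   | hub→arm refl _ _ _ | au , _ = ⊥-elim (true≢false (trans (sym au) a0))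
  ...   | arm→hub refl _ _ _ | _ , av , _ = ⊥-elim (true≢false (trans (sym av) a0))
  ...   | forward refl _ _ _ | au , av , _ = segment-pair-move α x m seg u v u (inj₁ (refl , refl)) (≤-pred lv) au au av lg
  ...   | backward refl _ _ _ | au , av , _ = segment-pair-move α x m seg u v v (inj₂ (refl , refl)) (≤-pred lu) au av au lg

  Segment-front : ∀ {α x m} → Segment α x (suc m) → 1 ≤ x × x ≤ N × α x ≡ true
  Segment-front {x = x} (_ , alive⇔ , range) with range (s≤s z≤n)
  ... | x1 , xN , _ = x1 , xN , proj₂ (alive⇔ x x1 xN) (≤-refl , m<m+n x (s≤s z≤n))

  Segment-frontEdge : ∀ {α x m} → Segment α x (suc (suc m)) → suc x ≤ N × E (pos α) x (suc x) ≡ true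
  Segment-frontEdge {α} {x} {m} seg@(_ , alive⇔ , range) with range (s≤s z≤n)
  ... | x1 , xN , xe = sxN , arm-edge α (arm x) x lx (start-arm≤ x x1 xN) (≤-trans sx<x+2+m xe) (proj₂ (proj₂ (Segment-front seg))) αsx
    where
    lx : arm x < K
    lx = proj₁ (arm-spec x x1 xN)
    sx<x+2+m : suc x < x + suc (suc m)
    sx<x+2+m = subst (_< x + suc (suc m)) (+-comm x 1) (+-monoʳ-< x (s≤s (s≤s z≤n)))
    sxN : suc x ≤ N
    sxN = proj₁ (proj₂ (in-arm (arm x) (suc x) lx (≤-trans (start-arm≤ x x1 xN) (n≤1+n x)) (<-≤-trans sx<x+2+m xe)))
    αsx : α (suc x) ≡ true
    αsx = proj₂ (alive⇔ (suc x) (s≤s z≤n) sxN) (n≤1+n x , sx<x+2+m)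

  grundy-segment : ∀ F α x m → Segment α x m → m ≤ F → grundyF F (pos α) ≡ mod3 m
  grundy-segment zero α x zero seg _ = refl
  grundy-segment (suc F) α x m seg lm = mex≡mod3 m (options F (pos α)) options-shorter one-less two-less
    where
    options-shorter : ∀ v → v ∈ options F (pos α) → ∃ λ m′ → v ≡ mod3 m′ × (suc m′ ≡ m ⊎ suc (suc m′) ≡ m)
    options-shorter v mv with options⁻ F (pos α) v mv
    ... | X , move , refl with segment-move α x m seg X move
    ... | x′ , m′ , seg′ , inj₁ e = m′ , grundy-segment F _ x′ m′ seg′ (≤-pred (≤-trans (≤-reflexive e) lm)) , inj₁ e
    ... | x′ , m′ , seg′ , inj₂ e = m′ , grundy-segment F _ x′ m′ seg′ (≤-pred (≤-trans (≤-trans (n≤1+n _) (≤-reflexive e)) lm)) , inj₂ e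
    one-less : ∀ m₁ → suc m₁ ≡ m → mod3 m₁ ∈ options F (pos α)
    one-less m₁ refl with Segment-front seg
    ... | _ , xN , αx = subst (_∈ options F (pos α)) (grundy-segment F _ (suc x) m₁ seg′ (≤-pred lm))
          (options⁺ F (pos α) (x ∷ []) (single∈candidates (pos α) x (s≤s xN) αx ,
             Connected⇒legal α x [] (Segment⇒Connected _ (suc x) m₁ seg′)))
      where
      seg′ : Segment (without (x ∷ []) α) (suc x) m₁
      seg′ = Segment-dropFirst₁ α x m₁ seg
    two-less : ∀ m₂ → suc (suc m₂) ≡ m → mod3 m₂ < mod3 m → mod3 m₂ ∈ options F (pos α)
    two-less m₂ refl _ with Segment-front seg | Segment-frontEdge seg
    ... | _ , xN , _ | sxN , edge = subst (_∈ options F (pos α)) (grundy-segment F _ (suc (suc x)) m₂ seg′ (≤-trans (n≤1+n m₂) (≤-pred lm)))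
          (options⁺ F (pos α) (x ∷ suc x ∷ []) (pair∈candidates (pos α) x (suc x) (s≤s xN) (s≤s sxN) edge ,
             Connected⇒legal α x (suc x ∷ []) (Segment⇒Connected _ (suc (suc x)) m₂ seg′)))
      where
      seg′ : Segment (without (x ∷ suc x ∷ []) α) (suc (suc x)) m₂
      seg′ = Segment-dropFirst₂ α x m₂ x (suc x) (inj₁ (refl , refl)) seg


  Truncated-alive⁻ : ∀ α as → Truncated α as → ∀ w → 1 ≤ w → w ≤ N → α w ≡ true →
    arm w < K × start (arm w) ≤ w × w < start (arm w) + at as (arm w)
  Truncated-alive⁻ α as (_ , _ , _ , alive⇔) w w1 wN aw with arm-spec w w1 wN
  ... | li , lo , _ = li , lo , proj₁ (alive⇔ w w1 wN) aw

  Truncated-alive⁺ : ∀ α as → Truncated α as → ∀ i w → i < K → start i ≤ w → w < start i + at as i →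
    1 ≤ w × w ≤ N × arm w ≡ i × α w ≡ true
  Truncated-alive⁺ α as (_ , _ , ale , alive⇔) i w li l1 l2 with in-arm i w li l1 (<-≤-trans l2 (+-monoʳ-≤ (start i) (ale i)))
  ... | w1 , wN , ai = w1 , wN , ai , proj₂ (alive⇔ w w1 wN) (subst (λ z → w < start z + at as z) (sym ai) l2)

  Truncated-armStart : ∀ α as → Truncated α as → ∀ k → k < K → 1 ≤ at as k →
    1 ≤ start k × start k ≤ N × arm (start k) ≡ k × α (start k) ≡ true
  Truncated-armStart α as tr k lk pk = Truncated-alive⁺ α as tr k (start k) lk ≤-refl (m<m+n (start k) pk)

  Truncated-emptyArm : ∀ α as → Truncated α as → ∀ w → 1 ≤ w → w ≤ N → at as (arm w) ≡ 0 → α w ≡ true → ⊥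
  Truncated-emptyArm α as tr w w1 wN z aw with Truncated-alive⁻ α as tr w w1 wN aw
  ... | _ , lo , lt = ≤⇒≯ lo (subst (w <_) (trans (cong (start (arm w) +_) z) (+-identityʳ _)) lt)

  Truncated-restrict : ∀ α X as as′ → Truncated α as → (0 ∈ᵇ X) ≡ false → length as′ ≡ K → (∀ i → at as′ i ≤ len i) →
    (∀ w → 1 ≤ w → w ≤ N → w < start (arm w) + at as (arm w) → (w ∈ᵇ X) ≡ false → w < start (arm w) + at as′ (arm w)) →
    (∀ w → 1 ≤ w → w ≤ N → w < start (arm w) + at as′ (arm w) → w < start (arm w) + at as (arm w) × (w ∈ᵇ X) ≡ false) →
    Truncated (without X α) as′
  Truncated-restrict α X as as′ (a0 , _ , _ , alive⇔) 0∉X length≡ arms≤ kept within =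
    without-true⁺ X α 0 a0 0∉X , length≡ , arms≤ ,
    λ w w1 wN → (λ e → let (aw , w∉X) = without-true⁻ X α w e in kept w w1 wN (proj₁ (alive⇔ w w1 wN) aw) w∉X) ,
                (λ l → let (l′ , w∉X) = within w w1 wN l in without-true⁺ X α w (proj₂ (alive⇔ w w1 wN) l′) w∉X)

  Truncated-shorten₁ : ∀ α as i → Truncated α as → i < K → 1 ≤ at as i →
    Truncated (without (start i + pred (at as i) ∷ []) α) (modifyAt as i pred)
  Truncated-shorten₁ α as i tr@(_ , length≡ , arms≤ , _) li pi =
    Truncated-restrict α (v ∷ []) as (modifyAt as i pred) tr (∉single 0 v (λ e → <-irrefl e v1))
      (trans (length-modifyAt as i pred) length≡) (λ j → ≤-trans (at-modifyAt-≤ as i pred j (λ _ → pred[n]≤n)) (arms≤ j)) kept within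
    where
    v : ℕ
    v = start i + pred (at as i)
    li′ : i < length as
    li′ = subst (i <_) (sym length≡) li
    end≡ : suc v ≡ start i + at as i
    end≡ = +-pred-end (start i) (at as i) pi
    v1 : 1 ≤ v
    v1 = proj₁ (Truncated-alive⁺ α as tr i v li (m≤m+n _ _) (subst (v <_) end≡ (n<1+n v)))
    kept : ∀ w → 1 ≤ w → w ≤ N → w < start (arm w) + at as (arm w) → (w ∈ᵇ (v ∷ [])) ≡ false →
      w < start (arm w) + at (modifyAt as i pred) (arm w)
    kept w w1 wN l w∉X with arm w ≟ i
    ... | yes refl rewrite at-modifyAt-same as (arm w) pred li′ = ≤∧≢⇒< (≤-pred (subst (w <_) (sym end≡) l)) (∉single⁻ w v w∉X)
    ... | no ne rewrite at-modifyAt-other as i (arm w) pred (ne ∘ sym) = l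
    within : ∀ w → 1 ≤ w → w ≤ N → w < start (arm w) + at (modifyAt as i pred) (arm w) →
      w < start (arm w) + at as (arm w) × (w ∈ᵇ (v ∷ [])) ≡ false
    within w w1 wN l with arm w ≟ i
    ... | yes refl rewrite at-modifyAt-same as (arm w) pred li′ = <-trans l (subst (v <_) end≡ (n<1+n v)) , ∉single w v (λ e → <-irrefl e l)
    ... | no ne rewrite at-modifyAt-other as i (arm w) pred (ne ∘ sym) = l , ∉single w v (λ e → ne (trans (cong arm e) v-arm))
      where
      v-arm : arm v ≡ i
      v-arm = proj₁ (proj₂ (proj₂ (Truncated-alive⁺ α as tr i v li (m≤m+n _ _) (subst (v <_) end≡ (n<1+n v)))))

  Truncated-shorten₂ : ∀ α as i u v → Truncated α as → i < K → 2 ≤ at as i →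
    IsPair u v (start i + pred (pred (at as i))) (suc (start i + pred (pred (at as i)))) →
    Truncated (without (u ∷ v ∷ []) α) (modifyAt as i (pred ∘ pred))
  Truncated-shorten₂ α as i u v tr@(_ , length≡ , arms≤ , _) li pi pair =
    Truncated-restrict α X as (modifyAt as i (pred ∘ pred)) tr (∉pair 0 u v lo (suc lo) pair (λ e → <-irrefl e lo1) (λ ()))
      (trans (length-modifyAt as i (pred ∘ pred)) length≡) (λ j → ≤-trans (at-modifyAt-≤ as i (pred ∘ pred) j pred²≤) (arms≤ j)) kept within
    where
    lo : ℕ
    lo = start i + pred (pred (at as i))
    X : List ℕ
    X = u ∷ v ∷ []
    li′ : i < length as
    li′ = subst (i <_) (sym length≡) li
    end≡ : suc (suc lo) ≡ start i + at as i
    end≡ = +-pred²-end (start i) (at as i) pi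
    lo<end : lo < start i + at as i
    lo<end = subst (lo <_) end≡ (≤-trans (n<1+n lo) (n≤1+n (suc lo)))
    slo<end : suc lo < start i + at as i
    slo<end = subst (suc lo <_) end≡ (n<1+n (suc lo))
    lo1 : 1 ≤ lo
    lo1 = proj₁ (Truncated-alive⁺ α as tr i lo li (m≤m+n _ _) lo<end)
    lo-arm : arm lo ≡ i
    lo-arm = proj₁ (proj₂ (proj₂ (Truncated-alive⁺ α as tr i lo li (m≤m+n _ _) lo<end)))
    slo-arm : arm (suc lo) ≡ i
    slo-arm = proj₁ (proj₂ (proj₂ (Truncated-alive⁺ α as tr i (suc lo) li (≤-trans (m≤m+n _ _) (n≤1+n lo)) slo<end)))
    kept : ∀ w → 1 ≤ w → w ≤ N → w < start (arm w) + at as (arm w) → (w ∈ᵇ X) ≡ false →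
      w < start (arm w) + at (modifyAt as i (pred ∘ pred)) (arm w)
    kept w w1 wN l w∉X with arm w ≟ i
    ... | yes refl rewrite at-modifyAt-same as (arm w) (pred ∘ pred) li′ =
         let (w≢lo , w≢slo) = ∉pair⁻ w u v lo (suc lo) pair w∉X in
         ≤∧≢⇒< (≤-pred (≤∧≢⇒< (≤-pred (subst (w <_) (sym end≡) l)) w≢slo)) w≢lo
    ... | no ne rewrite at-modifyAt-other as i (arm w) (pred ∘ pred) (ne ∘ sym) = l
    within : ∀ w → 1 ≤ w → w ≤ N → w < start (arm w) + at (modifyAt as i (pred ∘ pred)) (arm w) →
      w < start (arm w) + at as (arm w) × (w ∈ᵇ X) ≡ false
    within w w1 wN l with arm w ≟ i
    ... | yes refl rewrite at-modifyAt-same as (arm w) (pred ∘ pred) li′ =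
          <-trans l lo<end , ∉pair w u v lo (suc lo) pair (λ e → <-irrefl e l) (λ e → <-irrefl e (<-trans l (n<1+n lo)))
    ... | no ne rewrite at-modifyAt-other as i (arm w) (pred ∘ pred) (ne ∘ sym) =
          l , ∉pair w u v lo (suc lo) pair (λ e → ne (trans (cong arm e) lo-arm)) (λ e → ne (trans (cong arm e) slo-arm))

  arm-cut-illegal : ∀ α as → Truncated α as → ∀ y Y i t w → y ≤ N → α y ≡ true → i < K →
    start i < t → t < start i + at as i → (pred t ∈ᵇ (y ∷ Y)) ≡ true → (t ∈ᵇ (y ∷ Y)) ≡ false →
    w ≤ N → α w ≡ true → (w ∈ᵇ (y ∷ Y)) ≡ false → tailSet i t w ≡ false → legal (pos α) (y ∷ Y) ≡ true → ⊥
  arm-cut-illegal α as tr y Y i t w yN ay li start<t t<end pt∈X t∉X wN aw w∉X w∉tail lg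
    with Truncated-alive⁺ α as tr i t li (<⇒≤ start<t) t<end
  ... | t1 , tN , ti , αt = cut⇒illegal α (Truncated⇒Connected α as tr) y Y i t w cut yN ay αt t∉X wN aw w∉X w∉tail lg
    where
    cut : TailCut (without (y ∷ Y) α) i t
    cut = ti , t1 , tN , (λ e → ⊥-elim (<-irrefl (sym e) start<t)) , (λ _ → without-deleted (y ∷ Y) α (pred t) pt∈X)

  hub-cut-illegal : ∀ α as → Truncated α as → ∀ y Y i j → y ≤ N → α y ≡ true → (0 ∈ᵇ (y ∷ Y)) ≡ true →
    i ≢ j → i < K → j < K → 1 ≤ at as i → 1 ≤ at as j →
    (start i ∈ᵇ (y ∷ Y)) ≡ false → (start j ∈ᵇ (y ∷ Y)) ≡ false → legal (pos α) (y ∷ Y) ≡ true → ⊥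
  hub-cut-illegal α as tr y Y i j yN ay 0∈X i≢j li lj pi pj si∉X sj∉X lg
    with Truncated-armStart α as tr i li pi | Truncated-armStart α as tr j lj pj
  ... | si1 , siN , si-arm , αsi | _ , sjN , sj-arm , αsj =
    cut⇒illegal α (Truncated⇒Connected α as tr) y Y i (start i) (start j) cut yN ay αsi si∉X sjN αsj sj∉X sj∉tail lg
    where
    cut : TailCut (without (y ∷ Y) α) i (start i)
    cut = si-arm , si1 , siN , (λ _ → without-deleted (y ∷ Y) α 0 0∈X) , (λ l → ⊥-elim (<-irrefl refl l))
    sj∉tail : tailSet i (start i) (start j) ≡ false
    sj∉tail = tailSet-false⁺ i (start i) (start j) (λ c → i≢j (trans (sym (proj₁ (proj₂ (proj₂ (tailSet-true⁻ i (start i) (start j) c))))) sj-arm))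

  Truncated⇒Segment : ∀ α as X k x m → Truncated α as → (0 ∈ᵇ X) ≡ true → k < K → start k ≤ x → x + m ≡ start k + at as k →
    (∀ w → 1 ≤ w → w ≤ N → α w ≡ true → (w ∈ᵇ X) ≡ false → arm w ≡ k × x ≤ w) →
    (∀ w → x ≤ w → w < x + m → (w ∈ᵇ X) ≡ false) →
    Segment (without X α) x m
  Truncated⇒Segment α as X k x m tr@(_ , _ , arms≤ , _) 0∈X lk start≤x end≡ survivors kept =
    without-deleted X α 0 0∈X , alive⇔ , range
    where
    alive⇔ : ∀ w → 1 ≤ w → w ≤ N → (without X α w ≡ true) ⟺ (x ≤ w × w < x + m)
    alive⇔ w w1 wN =
      (λ e → let (aw , w∉X) = without-true⁻ X α w e ; (wk , x≤w) = survivors w w1 wN aw w∉X in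
        x≤w , subst (w <_) (trans (cong (λ z → start z + at as z) wk) (sym end≡)) (proj₂ (proj₂ (Truncated-alive⁻ α as tr w w1 wN aw)))) ,
      (λ { (x≤w , w<x+m) → without-true⁺ X α w
             (proj₂ (proj₂ (proj₂ (Truncated-alive⁺ α as tr k w lk (≤-trans start≤x x≤w) (subst (w <_) end≡ w<x+m))))) (kept w x≤w w<x+m) })
    range : 1 ≤ m → 1 ≤ x × x ≤ N × x + m ≤ start (arm x) + len (arm x)
    range 1≤m with in-arm k x lk start≤x (<-≤-trans (subst (x <_) end≡ (m<m+n x 1≤m)) (+-monoʳ-≤ (start k) (arms≤ k)))
    ... | x1 , xN , xk = x1 , xN , subst (λ z → x + m ≤ start z + len z) (sym xk) (≤-trans (≤-reflexive end≡) (+-monoʳ-≤ (start k) (arms≤ k)))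

  Truncated⇒emptySegment : ∀ α as X → Truncated α as → (0 ∈ᵇ X) ≡ true →
    (∀ w → 1 ≤ w → w ≤ N → α w ≡ true → (w ∈ᵇ X) ≡ true) → Segment (without X α) 1 0
  Truncated⇒emptySegment α as X tr 0∈X all-deleted =
    without-deleted X α 0 0∈X ,
    (λ w w1 wN → (λ e → let (aw , w∉X) = without-true⁻ X α w e in ⊥-elim (true≢false (trans (sym (all-deleted w w1 wN aw)) w∉X))) ,
                 (λ { (1≤w , w<1) → ⊥-elim (≤⇒≯ 1≤w (subst (w <_) (+-identityʳ 1) w<1)) })) ,
    (λ ())

  MoveFromTruncated : (ℕ → Bool) → List ℕ → List ℕ → Set
  MoveFromTruncated α as X =
    (∃ λ as′ → IsShortening as as′ × Truncated (without X α) as′) ⊎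
    (∃ λ x → ∃ λ m → Segment (without X α) x m × countPositive as ≤ 2 × (m ≡ sum as ⊎ suc m ≡ sum as))

  start≢0 : ∀ i → start i ≢ 0
  start≢0 i e = <-irrefl (sym e) (start≥1 i)

  sole-arm-survivors : ∀ α as i → Truncated α as → (∀ j → j ≢ i → at as j ≡ 0) →
    ∀ w → 1 ≤ w → w ≤ N → α w ≡ true → arm w ≡ i × start i ≤ w
  sole-arm-survivors α as i tr others w w1 wN aw with arm w ≟ i
  ... | yes refl = refl , proj₁ (proj₂ (Truncated-alive⁻ α as tr w w1 wN aw))
  ... | no ne = ⊥-elim (Truncated-emptyArm α as tr w w1 wN (others (arm w) ne) aw)

  truncated-move-hub : ∀ α as → Truncated α as → legal (pos α) (0 ∷ []) ≡ true → MoveFromTruncated α as (0 ∷ [])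
  truncated-move-hub α as tr@(a0 , length≡ , _ , _) lg with 2 ≤? countPositive as
  ... | yes 2≤cp with countPositive>0⇒positive as (≤-trans (s≤s z≤n) 2≤cp)
  ...   | i , li , pi with another-positive as 2≤cp i
  ...     | j , j≢i , lj , pj = ⊥-elim (hub-cut-illegal α as tr 0 [] i j z≤n a0 (∈single 0) (j≢i ∘ sym)
            (subst (i <_) length≡ li) (subst (j <_) length≡ lj) pi pj
            (∉single (start i) 0 (start≢0 i)) (∉single (start j) 0 (start≢0 j)) lg)
  truncated-move-hub α as tr@(a0 , length≡ , _ , _) lg | no cp≱2 with countPositive as ≟ 0
  ... | yes cp≡0 = inj₂ (1 , 0 , Truncated⇒emptySegment α as (0 ∷ []) tr (∈single 0) nothing-alive , cp≤2 , inj₁ (sym sum≡0))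
    where
    cp≤2 : countPositive as ≤ 2
    cp≤2 = ≤-trans (≤-pred (≰⇒> cp≱2)) (n≤1+n 1)
    nothing-alive : ∀ w → 1 ≤ w → w ≤ N → α w ≡ true → (w ∈ᵇ (0 ∷ [])) ≡ true
    nothing-alive w w1 wN aw = ⊥-elim (Truncated-emptyArm α as tr w w1 wN (countPositive≡0⇒zero as cp≡0 (arm w)) aw)
    sum≡0 : sum as ≡ 0
    sum≡0 = all-zero⇒sum≡0 as (countPositive≡0⇒zero as cp≡0)
  ... | no cp≢0 with countPositive>0⇒positive as (n≢0⇒n>0 cp≢0)
  ...   | i , li , pi = inj₂ (start i , at as i ,
            Truncated⇒Segment α as (0 ∷ []) i (start i) (at as i) tr (∈single 0) (subst (i <_) length≡ li) ≤-refl refl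
              (λ w w1 wN aw _ → sole-arm-survivors α as i tr others w w1 wN aw)
              (λ w s≤w _ → ∉single w 0 (λ e → start≢0 i (n≤0⇒n≡0 (subst (start i ≤_) e s≤w)))) ,
            ≤-trans (≤-pred (≰⇒> cp≱2)) (n≤1+n 1) , inj₁ (sym (sum-sole-positive as i li others)))
    where
    others : ∀ j → j ≢ i → at as j ≡ 0
    others = sole-positive as i (≤-pred (≰⇒> cp≱2)) li pi

  truncated-move-arm : ∀ α as → Truncated α as → ∀ v → 1 ≤ v → v ≤ N → α v ≡ true → legal (pos α) (v ∷ []) ≡ true →
    MoveFromTruncated α as (v ∷ [])
  truncated-move-arm α as tr@(a0 , length≡ , _ , _) v v1 vN av lg with Truncated-alive⁻ α as tr v v1 vN av
  ... | li , lo , lt with suc v ≟ start (arm v) + at as (arm v)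
  ...   | no not-last = ⊥-elim (arm-cut-illegal α as tr v [] (arm v) (suc v) 0 vN av li (s≤s lo) (≤∧≢⇒< lt not-last)
            (∈single v) (∉single (suc v) v (λ e → <-irrefl (sym e) (n<1+n v))) z≤n a0 (∉single 0 v (λ e → <-irrefl e v1)) refl lg)
  ...   | yes last = inj₁ (modifyAt as i pred , (i , li′ , inj₁ (pi , refl)) ,
            subst (λ z → Truncated (without (z ∷ []) α) (modifyAt as i pred)) (sym v≡) (Truncated-shorten₁ α as i tr li pi))
    where
    i : ℕ
    i = arm v
    li′ : i < length as
    li′ = subst (i <_) (sym length≡) li
    pi : 1 ≤ at as i
    pi = +-cancelˡ-≤ (start i) 1 (at as i) (≤-trans (≤-reflexive (+-comm (start i) 1)) (≤-trans (s≤s lo) (≤-reflexive last)))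
    v≡ : v ≡ start i + pred (at as i)
    v≡ = suc-injective (trans last (sym (+-pred-end (start i) (at as i) pi)))

  truncated-move-armPair : ∀ α as → Truncated α as → ∀ u v lo → IsPair u v lo (suc lo) → 1 ≤ lo → suc lo ≤ N →
    arm lo ≡ arm (suc lo) → α u ≡ true → α lo ≡ true → α (suc lo) ≡ true → legal (pos α) (u ∷ v ∷ []) ≡ true →
    MoveFromTruncated α as (u ∷ v ∷ [])
  truncated-move-armPair α as tr@(a0 , length≡ , _ , _) u v lo pair lo1 sloN arm≡ au alo aslo lg
    with Truncated-alive⁻ α as tr lo lo1 (≤-trans (n≤1+n lo) sloN) alo | Truncated-alive⁻ α as tr (suc lo) (s≤s z≤n) sloN aslo
  ... | li , lo≥start , _ | _ , _ , slo<end with suc (suc lo) ≟ start (arm lo) + at as (arm lo)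
  ...   | no not-last = ⊥-elim (arm-cut-illegal α as tr u (v ∷ []) (arm lo) (suc (suc lo)) 0 uN au li
            (s≤s (≤-trans lo≥start (n≤1+n lo))) (≤∧≢⇒< (subst (λ z → suc lo < start z + at as z) (sym arm≡) slo<end) not-last)
            (∈pair₂ u v lo (suc lo) pair)
            (∉pair (suc (suc lo)) u v lo (suc lo) pair (λ e → <-irrefl (sym e) (≤-trans (n<1+n lo) (n≤1+n (suc lo)))) (λ e → <-irrefl (sym e) (n<1+n (suc lo))))
            z≤n a0 (∉pair 0 u v lo (suc lo) pair (λ e → <-irrefl e lo1) (λ ())) refl lg)
    where
    uN : u ≤ N
    uN = IsPair-≤ pair (≤-trans (n≤1+n lo) sloN) sloN
  ...   | yes last = inj₁ (modifyAt as i (pred ∘ pred) , (i , subst (i <_) (sym length≡) li , inj₂ (pi , refl)) ,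
            Truncated-shorten₂ α as i u v tr li pi (subst (λ z → IsPair u v z (suc z)) lo≡ pair))
    where
    i : ℕ
    i = arm lo
    pi : 2 ≤ at as i
    pi = +-cancelˡ-≤ (start i) 2 (at as i) (≤-trans (≤-reflexive (+-comm (start i) 2)) (≤-trans (s≤s (s≤s lo≥start)) (≤-reflexive last)))
    lo≡ : lo ≡ start i + pred (pred (at as i))
    lo≡ = suc-injective (suc-injective (trans last (sym (+-pred²-end (start i) (at as i) pi))))

  module HubPair (α : ℕ → Bool) (as : List ℕ) (tr : Truncated α as) (u v s : ℕ) (pair : IsPair u v 0 s)
    (s1 : 1 ≤ s) (sN : s ≤ N) (s≡ : s ≡ start (arm s)) (αs : α s ≡ true) (au : α u ≡ true) (lg : legal (pos α) (u ∷ v ∷ []) ≡ true) where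

    X : List ℕ
    X = u ∷ v ∷ []
    j : ℕ
    j = arm s

    uN : u ≤ N
    uN = IsPair-≤ pair z≤n sN

    lj : j < K
    lj = proj₁ (Truncated-alive⁻ α as tr s s1 sN αs)

    lj′ : j < length as
    lj′ = subst (j <_) (sym (proj₁ (proj₂ tr))) lj

    pj : 1 ≤ at as j
    pj = +-cancelˡ-≤ s 1 (at as j) (≤-trans (≤-reflexive (+-comm s 1))
           (subst (λ z → suc s ≤ z + at as j) (sym s≡) (proj₂ (proj₂ (Truncated-alive⁻ α as tr s s1 sN αs)))))

    0∈X : (0 ∈ᵇ X) ≡ true
    0∈X = ∈pair₁ u v 0 s pair

    other-start∉X : ∀ k → k ≢ j → k < K → 1 ≤ at as k → (start k ∈ᵇ X) ≡ false
    other-start∉X k k≢j lk pk = ∉pair (start k) u v 0 s pair (start≢0 k) (λ e → k≢j (trans (sym start-arm) (cong arm e)))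
      where
      start-arm : arm (start k) ≡ k
      start-arm = proj₁ (proj₂ (proj₂ (Truncated-armStart α as tr k lk pk)))

    s∈X : (s ∈ᵇ X) ≡ true
    s∈X = ∈pair₂ u v 0 s pair

    three-arms-illegal : 3 ≤ countPositive as → ⊥
    three-arms-illegal 3≤cp with two-other-positives as 3≤cp j
    ... | k₁ , k₂ , k₁≢j , k₂≢j , k₁≢k₂ , lk₁ , lk₂ , pk₁ , pk₂ =
      hub-cut-illegal α as tr u (v ∷ []) k₁ k₂ uN au 0∈X k₁≢k₂ (toK lk₁) (toK lk₂) pk₁ pk₂
        (other-start∉X k₁ k₁≢j (toK lk₁) pk₁) (other-start∉X k₂ k₂≢j (toK lk₂) pk₂) lg
      where
      toK : ∀ {k} → k < length as → k < K
      toK = subst (_ <_) (proj₁ (proj₂ tr))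

    cp≤2 : ¬ 3 ≤ countPositive as → countPositive as ≤ 2
    cp≤2 cp≱3 = ≤-pred (≰⇒> cp≱3)

    two-arms : ¬ 3 ≤ countPositive as → 2 ≤ countPositive as → MoveFromTruncated α as X
    two-arms cp≱3 2≤cp with another-positive as 2≤cp j
    ... | k , k≢j , lk′ , pk with Truncated-armStart α as tr k lk pk | 2 ≤? at as j
      where
      lk : k < K
      lk = subst (k <_) (proj₁ (proj₂ tr)) lk′
    ...   | _ , skN , sk-arm , αsk | yes long = ⊥-elim (arm-cut-illegal α as tr u (v ∷ []) j (suc s) (start k) uN au lj
              (subst (_< suc s) s≡ (n<1+n s)) (subst (λ z → suc s < z + at as j) s≡ (subst (_< s + at as j) (+-comm s 1) (+-monoʳ-< s long)))
              s∈X (∉pair (suc s) u v 0 s pair (λ ()) (λ e → <-irrefl (sym e) (n<1+n s)))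
              skN αsk (other-start∉X k k≢j (subst (k <_) (proj₁ (proj₂ tr)) lk′) pk)
              (tailSet-false⁺ j (suc s) (start k) (λ c → k≢j (trans (sym sk-arm) (proj₁ (proj₂ (proj₂ (tailSet-true⁻ j (suc s) (start k) c)))))))
              lg)
    ...   | _ , _ , sk-arm , _ | no short =
      inj₂ (start k , at as k , Truncated⇒Segment α as X k (start k) (at as k) tr 0∈X lk ≤-refl refl survivors kept ,
            cp≤2 cp≱3 , inj₂ (sym (trans (sum-two-positive as j k (k≢j ∘ sym) lj′ lk′ others) (cong (_+ at as k) aj≡1))))
      where
      lk : k < K
      lk = subst (k <_) (proj₁ (proj₂ tr)) lk′
      aj≡1 : at as j ≡ 1
      aj≡1 = ≤-antisym (≤-pred (≰⇒> short)) pj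
      others : ∀ l → l ≢ j → l ≢ k → at as l ≡ 0
      others l l≢j l≢k with at as l in al
      ... | zero = refl
      ... | suc _ = ⊥-elim (cp≱3 (three-positive⇒3≤countPositive as j k l (k≢j ∘ sym) (l≢j ∘ sym) (l≢k ∘ sym) lj′ lk′ pj pk
                      (subst (1 ≤_) (sym al) (s≤s z≤n))))
      survivors : ∀ w → 1 ≤ w → w ≤ N → α w ≡ true → (w ∈ᵇ X) ≡ false → arm w ≡ k × start k ≤ w
      survivors w w1 wN aw w∉X with arm w ≟ k | Truncated-alive⁻ α as tr w w1 wN aw
      ... | yes refl | _ , lo , _ = refl , lo
      ... | no w≢k | _ , lo , lt with arm w ≟ j
      ...   | no w≢j = ⊥-elim (Truncated-emptyArm α as tr w w1 wN (others (arm w) w≢j w≢k) aw)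
      ...   | yes wj = ⊥-elim (proj₂ (∉pair⁻ w u v 0 s pair w∉X) (≤-antisym (≤-pred w<1+s) s≤w))
        where
        w<1+s : w < suc s
        w<1+s = subst (w <_) (trans (cong (λ z → start z + at as z) wj) (trans (cong (_+ at as j) (sym s≡)) (trans (cong (s +_) aj≡1) (+-comm s 1)))) lt
        s≤w : s ≤ w
        s≤w = subst (_≤ w) (trans (cong start wj) (sym s≡)) lo
      kept : ∀ w → start k ≤ w → w < start k + at as k → (w ∈ᵇ X) ≡ false
      kept w l1 l2 with Truncated-alive⁺ α as tr k w lk l1 l2
      ... | w1 , _ , wk , _ = ∉pair w u v 0 s pair (λ e → <-irrefl (sym e) w1) (λ e → k≢j (trans (sym wk) (cong arm e)))

    one-arm : ¬ 2 ≤ countPositive as → MoveFromTruncated α as X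
    one-arm cp≱2 =
      inj₂ (suc s , pred (at as j) , Truncated⇒Segment α as X j (suc s) (pred (at as j)) tr 0∈X lj (subst (_≤ suc s) s≡ (n≤1+n s)) end≡ survivors kept ,
            ≤-trans (≤-pred (≰⇒> cp≱2)) (n≤1+n 1) , inj₂ (trans at≡ (sym (sum-sole-positive as j lj′ others))))
      where
      others : ∀ l → l ≢ j → at as l ≡ 0
      others = sole-positive as j (≤-pred (≰⇒> cp≱2)) lj′ pj
      at≡ : suc (pred (at as j)) ≡ at as j
      at≡ = suc-pred (at as j) ⦃ >-nonZero pj ⦄
      end≡ : suc s + pred (at as j) ≡ start j + at as j
      end≡ = trans (sym (+-suc s (pred (at as j)))) (trans (cong (s +_) at≡) (cong (_+ at as j) s≡))
      survivors : ∀ w → 1 ≤ w → w ≤ N → α w ≡ true → (w ∈ᵇ X) ≡ false → arm w ≡ j × suc s ≤ w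
      survivors w w1 wN aw w∉X with sole-arm-survivors α as j tr others w w1 wN aw
      ... | wj , lo = wj , ≤∧≢⇒< (subst (_≤ w) (sym s≡) lo) (proj₂ (∉pair⁻ w u v 0 s pair w∉X) ∘ sym)
      kept : ∀ w → suc s ≤ w → w < suc s + pred (at as j) → (w ∈ᵇ X) ≡ false
      kept w l1 _ = ∉pair w u v 0 s pair (λ e → <-irrefl (sym e) (≤-trans (s≤s z≤n) l1)) (λ e → <-irrefl (sym e) l1)

  truncated-move-hubPair : ∀ α as → Truncated α as → ∀ u v s → IsPair u v 0 s → 1 ≤ s → s ≤ N → s ≡ start (arm s) →
    α s ≡ true → α u ≡ true → legal (pos α) (u ∷ v ∷ []) ≡ true → MoveFromTruncated α as (u ∷ v ∷ [])
  truncated-move-hubPair α as tr u v s pair s1 sN s≡ αs au lg with 3 ≤? countPositive as | 2 ≤? countPositive as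
  ... | yes 3≤cp | _ = ⊥-elim (HubPair.three-arms-illegal α as tr u v s pair s1 sN s≡ αs au lg 3≤cp)
  ... | no cp≱3 | yes 2≤cp = HubPair.two-arms α as tr u v s pair s1 sN s≡ αs au lg cp≱3 2≤cp
  ... | no _ | no cp≱2 = HubPair.one-arm α as tr u v s pair s1 sN s≡ αs au lg cp≱2

  truncated-move : ∀ α as → Truncated α as → ∀ X → Move (pos α) X → MoveFromTruncated α as X
  truncated-move α as tr X (mX , lg) with candidates⁻ (pos α) X mX
  ... | inj₁ (zero , refl , _ , _) = truncated-move-hub α as tr lg
  ... | inj₁ (suc v , refl , vl , av) = truncated-move-arm α as tr (suc v) (s≤s z≤n) (≤-pred vl) av lg
  ... | inj₂ (u , v , refl , _ , _ , e) with E⇒Adjacent α u v e | E-true⁻ (pos α) u v e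
  ...   | hub→arm refl v1 vN v≡ | au , av , _ = truncated-move-hubPair α as tr 0 v v (inj₁ (refl , refl)) v1 vN v≡ av au lg
  ...   | arm→hub refl u1 uN u≡ | au , av , _ = truncated-move-hubPair α as tr u 0 u (inj₂ (refl , refl)) u1 uN u≡ au au lg
  ...   | forward refl u1 vN a≡ | au , av , _ = truncated-move-armPair α as tr u v u (inj₁ (refl , refl)) u1 vN a≡ au au av lg
  ...   | backward refl v1 uN a≡ | au , av , _ = truncated-move-armPair α as tr u v v (inj₂ (refl , refl)) v1 uN (sym a≡) au av au lg

  shorten₁-move : ∀ α as → Truncated α as → ∀ i → i < K → 1 ≤ at as i →
    Move (pos α) (start i + pred (at as i) ∷ []) × Truncated (without (start i + pred (at as i) ∷ []) α) (modifyAt as i pred)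
  shorten₁-move α as tr i li pi = (single∈candidates (pos α) v (s≤s vN) αv , Connected⇒legal α v [] (Truncated⇒Connected _ (modifyAt as i pred) tr′)) , tr′
    where
    v : ℕ
    v = start i + pred (at as i)
    tr′ : Truncated (without (v ∷ []) α) (modifyAt as i pred)
    tr′ = Truncated-shorten₁ α as i tr li pi
    v-alive : 1 ≤ v × v ≤ N × arm v ≡ i × α v ≡ true
    v-alive = Truncated-alive⁺ α as tr i v li (m≤m+n _ _) (subst (v <_) (+-pred-end (start i) (at as i) pi) (n<1+n v))
    vN : v ≤ N
    vN = proj₁ (proj₂ v-alive)
    αv : α v ≡ true
    αv = proj₂ (proj₂ (proj₂ v-alive))

  shorten₂-move : ∀ α as → Truncated α as → ∀ i → i < K → 2 ≤ at as i →
    let lo = start i + pred (pred (at as i)) in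
    Move (pos α) (lo ∷ suc lo ∷ []) × Truncated (without (lo ∷ suc lo ∷ []) α) (modifyAt as i (pred ∘ pred))
  shorten₂-move α as tr@(_ , _ , arms≤ , _) i li pi =
    (pair∈candidates (pos α) lo (suc lo) (s≤s loN) (s≤s sloN) lo-edge , Connected⇒legal α lo (suc lo ∷ []) (Truncated⇒Connected _ (modifyAt as i (pred ∘ pred)) tr′)) , tr′
    where
    lo : ℕ
    lo = start i + pred (pred (at as i))
    tr′ : Truncated (without (lo ∷ suc lo ∷ []) α) (modifyAt as i (pred ∘ pred))
    tr′ = Truncated-shorten₂ α as i lo (suc lo) tr li pi (inj₁ (refl , refl))
    slo<end : suc lo < start i + at as i
    slo<end = subst (suc lo <_) (+-pred²-end (start i) (at as i) pi) (n<1+n (suc lo))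
    lo-alive : 1 ≤ lo × lo ≤ N × arm lo ≡ i × α lo ≡ true
    lo-alive = Truncated-alive⁺ α as tr i lo li (m≤m+n _ _) (<-trans (n<1+n lo) slo<end)
    slo-alive : 1 ≤ suc lo × suc lo ≤ N × arm (suc lo) ≡ i × α (suc lo) ≡ true
    slo-alive = Truncated-alive⁺ α as tr i (suc lo) li (≤-trans (m≤m+n _ _) (n≤1+n lo)) slo<end
    loN : lo ≤ N
    loN = proj₁ (proj₂ lo-alive)
    sloN : suc lo ≤ N
    sloN = proj₁ (proj₂ slo-alive)
    lo-edge : E (pos α) lo (suc lo) ≡ true
    lo-edge = arm-edge α i lo li (m≤m+n _ _) (<-≤-trans slo<end (+-monoʳ-≤ (start i) (arms≤ i)))
                (proj₂ (proj₂ (proj₂ lo-alive))) (proj₂ (proj₂ (proj₂ slo-alive)))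

  hub-move : ∀ α as → Truncated α as → sum as ≡ 0 → Move (pos α) (0 ∷ []) × Segment (without (0 ∷ []) α) 1 0
  hub-move α as tr@(a0 , _) sum≡0 =
    (single∈candidates (pos α) 0 (s≤s z≤n) a0 , Connected⇒legal α 0 [] (Segment⇒Connected _ 1 0 seg)) , seg
    where
    seg : Segment (without (0 ∷ []) α) 1 0
    seg = Truncated⇒emptySegment α as (0 ∷ []) tr (∈single 0)
            (λ w w1 wN aw → ⊥-elim (Truncated-emptyArm α as tr w w1 wN (sum≡0⇒zero as sum≡0 (arm w)) aw))

  hubPair-move : ∀ α as → Truncated α as → ∀ i → i < K → at as i ≡ 1 → (∀ j → j ≢ i → at as j ≡ 0) →
    Move (pos α) (0 ∷ start i ∷ []) × Segment (without (0 ∷ start i ∷ []) α) 1 0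
  hubPair-move α as tr@(a0 , _ , arms≤ , _) i li ai≡1 others =
    (pair∈candidates (pos α) 0 (start i) (s≤s z≤n) (s≤s siN) hub-to-arm , Connected⇒legal α 0 (start i ∷ []) (Segment⇒Connected _ 1 0 seg)) , seg
    where
    X : List ℕ
    X = 0 ∷ start i ∷ []
    pair : IsPair 0 (start i) 0 (start i)
    pair = inj₁ (refl , refl)
    si : 1 ≤ start i × start i ≤ N × arm (start i) ≡ i × α (start i) ≡ true
    si = Truncated-armStart α as tr i li (≤-reflexive (sym ai≡1))
    siN : start i ≤ N
    siN = proj₁ (proj₂ si)
    hub-to-arm : E (pos α) 0 (start i) ≡ true
    hub-to-arm = hub-edge α i li (≤-trans (≤-reflexive (sym ai≡1)) (arms≤ i)) a0 (proj₂ (proj₂ (proj₂ si)))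
    only-start : ∀ w → 1 ≤ w → w ≤ N → α w ≡ true → (w ∈ᵇ X) ≡ true
    only-start w w1 wN aw with arm w ≟ i
    ... | no ne = ⊥-elim (Truncated-emptyArm α as tr w w1 wN (others (arm w) ne) aw)
    ... | yes refl with Truncated-alive⁻ α as tr w w1 wN aw
    ...   | _ , lo , lt = subst (λ z → (z ∈ᵇ X) ≡ true) w≡ (∈pair₂ 0 (start i) 0 (start i) pair)
      where
      w≡ : start i ≡ w
      w≡ = ≤-antisym lo (≤-pred (subst (w <_) (trans (cong (start i +_) ai≡1) (+-comm (start i) 1)) lt))
    seg : Segment (without X α) 1 0
    seg = Truncated⇒emptySegment α as X tr (∈pair₁ 0 (start i) 0 (start i) pair) only-start

-- Grundy values

module Grundy (ls : List ℕ) where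
  open Star ls
  open Positions ls

  GrundyTruncated : ℕ → Set
  GrundyTruncated F = ∀ α as → Truncated α as → sum as < F → grundyF F (pos α) ≡ starValue F as

  module Step (F : ℕ) (ih : GrundyTruncated F) (α : ℕ → Bool) (as : List ℕ) (tr : Truncated α as) (lf : sum as < suc F) where

    K≡ : length as ≡ K
    K≡ = proj₁ (proj₂ tr)

    shortening-value : ∀ y → y ∈ shortenings as → starValue F y ∈ options F (pos α)
    shortening-value y my with shortenings⁻ as y my
    ... | i , li , inj₁ (pi , refl) with shorten₁-move α as tr i (subst (i <_) K≡ li) pi
    ...   | move , tr′ = subst (_∈ options F (pos α)) (ih _ _ tr′ (<-≤-trans (sum-shortening< as y my) (≤-pred lf))) (options⁺ F (pos α) _ move)
    shortening-value y my | i , li , inj₂ (pi , refl) with shorten₂-move α as tr i (subst (i <_) K≡ li) pi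
    ...   | move , tr′ = subst (_∈ options F (pos α)) (ih _ _ tr′ (<-≤-trans (sum-shortening< as y my) (≤-pred lf))) (options⁺ F (pos α) _ move)

    branching-case : 3 ≤ countPositive as → grundyF (suc F) (pos α) ≡ mex (map (starValue F) (shortenings as))
    branching-case 3≤cp = mex-cong _ _ options⊆ shortenings⊆
      where
      options⊆ : ∀ v → v ∈ options F (pos α) → v ∈ map (starValue F) (shortenings as)
      options⊆ v mv with options⁻ F (pos α) v mv
      ... | X , move , refl with truncated-move α as tr X move
      ... | inj₁ (y , (i , li , inj₁ (p , refl)) , tr′) = subst (_∈ _) (sym (ih _ y tr′ (<-≤-trans (≤-reflexive (sum-shorten₁ as i li p)) (≤-pred lf))))
              (∈-map⁺ (starValue F) (shorten₁∈shortenings as i li p))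
      ... | inj₁ (y , (i , li , inj₂ (p , refl)) , tr′) = subst (_∈ _) (sym (ih _ y tr′ (<-≤-trans (≤-trans (n≤1+n _) (≤-reflexive (sum-shorten₂ as i li p))) (≤-pred lf))))
              (∈-map⁺ (starValue F) (shorten₂∈shortenings as i li p))
      ... | inj₂ (_ , _ , _ , path , _) = ⊥-elim (≤⇒≯ path 3≤cp)
      shortenings⊆ : ∀ v → v ∈ map (starValue F) (shortenings as) → v ∈ options F (pos α)
      shortenings⊆ v mv with ∈-map⁻ (starValue F) mv
      ... | y , my , refl = shortening-value y my

    module PathCase (path : countPositive as ≤ 2) where
      value-path : ∀ y → countPositive y ≤ 2 → sum y < F → ∀ X → Move (pos α) X → Truncated (without X α) y →
        mod3 (suc (sum y)) ∈ options F (pos α)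
      value-path y y-path ly X move tr′ =
        subst (_∈ options F (pos α)) (trans (ih _ y tr′ ly) (starValue-path′ F y y-path ly)) (options⁺ F (pos α) X move)

      value-empty : ∀ X → Move (pos α) X → Segment (without X α) 1 0 → 0 ∈ options F (pos α)
      value-empty X move seg = subst (_∈ options F (pos α)) (grundy-segment F _ 1 0 seg z≤n) (options⁺ F (pos α) X move)

      path₁ : ∀ i → i < length as → countPositive (modifyAt as i pred) ≤ 2
      path₁ i li = ≤-trans (countPositive-modifyAt-≤ as i pred li pred[n]≤n) path

      path₂ : ∀ i → i < length as → countPositive (modifyAt as i (pred ∘ pred)) ≤ 2
      path₂ i li = ≤-trans (countPositive-modifyAt-≤ as i (pred ∘ pred) li (pred²≤ _)) path

      options-of-path : ∀ v → v ∈ options F (pos α) → ∃ λ m′ → v ≡ mod3 m′ × (suc m′ ≡ suc (sum as) ⊎ suc (suc m′) ≡ suc (sum as))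
      options-of-path v mv with options⁻ F (pos α) v mv
      ... | X , move , refl with truncated-move α as tr X move
      ... | inj₁ (y , (i , li , inj₁ (p , refl)) , tr′) = suc (sum y) ,
            trans (ih _ y tr′ ly) (starValue-path′ F y (path₁ i li) ly) , inj₁ (cong suc (sum-shorten₁ as i li p))
        where
        ly : sum (modifyAt as i pred) < F
        ly = <-≤-trans (≤-reflexive (sum-shorten₁ as i li p)) (≤-pred lf)
      ... | inj₁ (y , (i , li , inj₂ (p , refl)) , tr′) = suc (sum y) ,
            trans (ih _ y tr′ ly) (starValue-path′ F y (path₂ i li) ly) , inj₂ (cong suc (sum-shorten₂ as i li p))
        where
        ly : sum (modifyAt as i (pred ∘ pred)) < F
        ly = <-≤-trans (≤-trans (n≤1+n _) (≤-reflexive (sum-shorten₂ as i li p))) (≤-pred lf)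
      ... | inj₂ (x , m , seg , _ , inj₁ m≡sum) = m , grundy-segment F _ x m seg (≤-trans (≤-reflexive m≡sum) (≤-pred lf)) , inj₁ (cong suc m≡sum)
      ... | inj₂ (x , m , seg , _ , inj₂ sm≡sum) = m , grundy-segment F _ x m seg (≤-trans (n≤1+n m) (≤-trans (≤-reflexive sm≡sum) (≤-pred lf))) , inj₂ (cong suc sm≡sum)

      one-less : ∀ m₁ → suc m₁ ≡ suc (sum as) → mod3 m₁ ∈ options F (pos α)
      one-less m₁ refl with sum as ≟ 0
      ... | yes sum≡0 = subst (λ z → mod3 z ∈ options F (pos α)) (sym sum≡0) (value-empty _ (proj₁ hm) (proj₂ hm))
        where
        hm : Move (pos α) (0 ∷ []) × Segment (without (0 ∷ []) α) 1 0
        hm = hub-move α as tr sum≡0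
      ... | no sum≢0 with positive-arm as (n≢0⇒n>0 sum≢0)
      ...   | i , li , pi with shorten₁-move α as tr i (subst (i <_) K≡ li) pi
      ...     | move , tr′ = subst (λ z → mod3 z ∈ options F (pos α)) (sum-shorten₁ as i li pi)
                (value-path (modifyAt as i pred) (path₁ i li) (<-≤-trans (≤-reflexive (sum-shorten₁ as i li pi)) (≤-pred lf)) _ move tr′)

      -- Without an arm of length ≥ 2 the star is a path on at most three vertices.
      two-less : ∀ m₂ → suc (suc m₂) ≡ suc (sum as) → mod3 m₂ < mod3 (suc (sum as)) → mod3 m₂ ∈ options F (pos α)
      two-less m₂ e lt with countPositive as <? sum as
      ... | yes cp<sum with long-arm as cp<sum
      ...   | i , li , pi with shorten₂-move α as tr i (subst (i <_) K≡ li) pi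
      ...     | move , tr′ = subst (λ z → mod3 z ∈ options F (pos α)) (suc-injective (trans (sum-shorten₂ as i li pi) (suc-injective (sym e))))
                (value-path (modifyAt as i (pred ∘ pred)) (path₂ i li) (<-≤-trans (≤-trans (n≤1+n _) (≤-reflexive (sum-shorten₂ as i li pi))) (≤-pred lf)) _ move tr′)
      two-less zero e lt | no cp≮sum with positive-arm as (≤-reflexive (suc-injective e))
      ... | i , li , pi = value-empty _ (proj₁ hm) (proj₂ hm)
        where
        others : ∀ j → j ≢ i → at as j ≡ 0
        others = sole-positive as i (≤-trans (countPositive≤sum as) (≤-reflexive (sym (suc-injective e)))) li pi
        hm : Move (pos α) (0 ∷ start i ∷ []) × Segment (without (0 ∷ start i ∷ []) α) 1 0
        hm = hubPair-move α as tr i (subst (i <_) K≡ li) (trans (sym (sum-sole-positive as i li others)) (sym (suc-injective e))) others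
      two-less (suc zero) e lt | no _ = ⊥-elim (mod3-1≮mod3-3 (subst (λ z → mod3 1 < mod3 (suc z)) (sym (suc-injective e)) lt))
        where
        mod3-1≮mod3-3 : ¬ mod3 1 < mod3 3
        mod3-1≮mod3-3 ()
      two-less (suc (suc m)) e lt | no cp≮sum = ⊥-elim (≤⇒≯ (≤-trans (≮⇒≥ cp≮sum) path) (subst (2 <_) (suc-injective e) (s≤s (s≤s (s≤s z≤n)))))

      path-case : grundyF (suc F) (pos α) ≡ mod3 (suc (sum as))
      path-case = mex≡mod3 (suc (sum as)) (options F (pos α)) options-of-path one-less two-less

  grundy-truncated : ∀ F → GrundyTruncated F
  grundy-truncated (suc F) α as tr lf with countPositive as ≤? 2
  ... | yes path = trans (Step.PathCase.path-case F (grundy-truncated F) α as tr lf path) (sym (starValue-path F as path))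
  ... | no branching = trans (Step.branching-case F (grundy-truncated F) α as tr lf (≰⇒> branching))
                             (sym (starValue-branching F as (≰⇒> branching)))

  star-Truncated : Truncated (λ _ → true) ls
  star-Truncated = refl , refl , (λ i → ≤-refl) , λ w w1 wN → (λ _ → proj₂ (proj₂ (arm-spec w w1 wN))) , (λ _ → refl)

  grundy-star : 𝒢 (star ls) ≡ starValue (suc (sum ls)) ls
  grundy-star = grundy-truncated (suc (sum ls)) (λ _ → true) ls star-Truncated ≤-refl

%3≡mod3 : ∀ x → x % 3 ≡ mod3 x
%3≡mod3 zero = refl
%3≡mod3 (suc zero) = refl
%3≡mod3 (suc (suc zero)) = refl
%3≡mod3 (suc (suc (suc k))) = trans (cong (_% 3) (+-comm 3 k)) (trans ([m+n]%n≡m%n k 3) (%3≡mod3 k))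

sum-map-mod3≤ : ∀ ls → sum (map mod3 ls) ≤ sum ls
sum-map-mod3≤ [] = z≤n
sum-map-mod3≤ (x ∷ ls) = +-mono-≤ (mod3≤ x) (sum-map-mod3≤ ls)

theorem2 : (ls : List ℕ) → All (1 ≤_) ls → 𝒢 (star ls) ≡ 𝒢 (star (map (_% 3) ls))
theorem2 ls _ = begin
  𝒢 (star ls)                                         ≡⟨ Grundy.grundy-star ls ⟩
  starValue (suc (sum ls)) ls                         ≡⟨ starValue-mod3 (suc (sum ls)) ls ≤-refl ⟩
  starValue (suc (sum ls)) (map mod3 ls)              ≡⟨ starValue-fuel _ _ (map mod3 ls) (s≤s (sum-map-mod3≤ ls)) ≤-refl ⟩
  starValue (suc (sum (map mod3 ls))) (map mod3 ls)   ≡⟨ sym (Grundy.grundy-star (map mod3 ls)) ⟩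
  𝒢 (star (map mod3 ls))                              ≡⟨ cong (𝒢 ∘ star) (map-cong %3≡mod3 ls) ⟨
  𝒢 (star (map (_% 3) ls))                            ∎
  where open ≡-Reasoning
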